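{- Let $q>7$ be a prime power. There is no set $S$ of $q+1$ points in $\mathrm{PG}(2,q)$ with $2q-2\le u_0(S)\le 3q-10$.
   Context: $\mathrm{PG}(2,q)$ is the projective plane over $\mathbb{F}_q$. For a set $S$ of $q+1$ points, $u_0(S)$ (the non-hitting index) is the number of lines of $\mathrm{PG}(2,q)$ containing no point of $S$. -}

module Defs where

open import Data.Nat using (ℕ; suc)
open import Data.Fin using (Fin)
open import Data.Fin.Properties using (_≟_)
open import Data.Product using (_×_; _,_; ∃)
open import Data.List using (List; []; _∷_; _++_; map; length; filter; allFin; cartesianProduct)
open import Data.List.Relation.Unary.All using (All; all?)
open import Relation.Binary.PropositionalEquality using (_≡_; _≢_)
open import Relation.Nullary using (¬_; Dec; ¬?)

open import Algebra.Core using (Op₁; Op₂)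
open import Algebra.Structures using (IsCommutativeRing)

-- A finite field with q elements, with carrier (a copy of) Fin q.
-- Every finite field of order q is in bijection with Fin q, so this is WLOG.
record FiniteField (q : ℕ) : Set where
  infixl 6 _+_
  infixl 7 _*_
  field
    _+_ _*_ : Op₂ (Fin q)
    -_      : Op₁ (Fin q)
    0# 1#   : Fin q
    isCommutativeRing : IsCommutativeRing _≡_ _+_ _*_ -_ 0# 1#
    0≢1     : 0# ≢ 1#
    inverse : ∀ x → x ≢ 0# → ∃ λ y → x * y ≡ 1#

module _ {q : ℕ} (F : FiniteField q) where
  open FiniteField F

  Triple : Set
  Triple = Fin q × Fin q × Fin q

  -- Points of PG(2,q): homogeneous coordinates normalised so that the
  -- first nonzero coordinate is 1:  (1,y,z), (0,1,z), (0,0,1).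
  -- (q^2 + q + 1 of them.)  Lines are represented the same way by their
  -- coordinate vectors [a,b,c].
  normalised : List Triple
  normalised =
    map (λ { (y , z) → (1# , y , z) }) (cartesianProduct (allFin q) (allFin q))
    ++ map (λ z → (0# , 1# , z)) (allFin q)
    ++ (0# , 0# , 1#) ∷ []

  points : List Triple
  points = normalised

  lines : List Triple
  lines = normalised

  Incident : Triple → Triple → Set
  Incident (a , b , c) (x , y , z) = a * x + b * y + c * z ≡ 0#

  incident? : ∀ ℓ p → Dec (Incident ℓ p)
  incident? (a , b , c) (x , y , z) = (a * x + b * y + c * z) ≟ 0#

  u₀ : List Triple → ℕ
  u₀ S = length (filter (λ ℓ → all? (λ p → ¬? (incident? ℓ p)) S) lines)

{-# OPTIONS --safe #-}
module Submission where

-- Write k(ℓ) = |ℓ ∩ S| and u = u₀(S).  Double counting incidences over the q² + q + 1 lines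
-- gives Σ k = (q + 1)² and Σ k² = (q + 1)(2q + 1).  If no line meets S in more than three
-- points, summing 3 + k² ≤ 4k + 3·[k = 0] over all lines yields q² ≤ 3u + 2q.  Otherwise fix a
-- line ℓ₀ with n ≥ 4 points of S; it has m = q + 1 − n points outside S, and S has m points
-- off ℓ₀.  Every external line meets ℓ₀ in one of those m points R, through each of which pass
-- at least n − 1 external lines and, as soon as m ≥ 1, at most q − 1 of them (at most q − 2
-- when R is off the line joining two points of S off ℓ₀).  Hence u ≤ 2q − 3 if m ≤ 2, and
-- u ≥ m(n − 1) ≥ 3q − 9 if m ≥ 3.  For q > 7 none of the three bounds allows
-- 2q − 2 ≤ u ≤ 3q − 10.

open import Defs
open import Data.Nat using (ℕ; zero; suc)
open import Data.Fin using (Fin)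
import Data.Fin.Properties as Fin
open import Data.Product using (_×_; _,_; ∃; proj₁; proj₂)
open import Data.Product.Properties using (≡-dec)
open import Data.Sum using (_⊎_; inj₁; inj₂; [_,_]′)
open import Data.Empty using (⊥-elim)
open import Data.Maybe using (nothing)
open import Data.List using (List; []; _∷_; _++_; map; length; filter; allFin; cartesianProduct)
open import Data.List.Properties using (map-++; length-tabulate)
open import Data.List.Membership.Propositional using (_∈_; _∉_; find)
open import Data.List.Membership.Propositional.Properties
  using (∈-map⁺; ∈-map⁻; ∈-++⁺ˡ; ∈-++⁺ʳ; ∈-++⁻; ∈-allFin; ∈-cartesianProduct⁺; ∈-filter⁻)
open import Data.List.Relation.Unary.Any using (here; there)
open import Data.List.Relation.Unary.All using (All; []; _∷_; all?)
import Data.List.Relation.Unary.All as All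
open import Data.List.Relation.Unary.All.Properties using (¬All⇒Any¬)
open import Data.List.Relation.Unary.AllPairs using ([]; _∷_)
open import Data.List.Relation.Unary.Unique.Propositional using (Unique)
open import Data.List.Relation.Unary.Unique.Propositional.Properties
  using (++⁺; map⁺; cartesianProduct⁺; allFin⁺; filter⁺; Unique[x∷xs]⇒x∉xs)
open import Relation.Nullary using (¬_; Dec; yes; no; ¬?)
open import Relation.Nullary.Decidable using (_×-dec_)
open import Relation.Unary using (Decidable)
open import Relation.Binary.Definitions using (DecidableEquality)
open import Relation.Binary.PropositionalEquality
open import Algebra.Bundles using (CommutativeRing)

module Coordinates {q : ℕ} (F : FiniteField q) where

  open FiniteField F
  private
    ring : CommutativeRing _ _
    ring = record { isCommutativeRing = isCommutativeRing }
  open CommutativeRing ring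
    using (+-comm; *-comm; *-identityˡ; *-identityʳ; zeroˡ; zeroʳ; +-identityˡ; +-identityʳ; -‿inverseˡ; _-_)
  open import Algebra.Properties.Ring (CommutativeRing.ring ring) using ([y-z]x≈yx-zx; x[y-z]≈xy-xz)
  open import Algebra.Properties.Group (CommutativeRing.+-group ring) using (x∙y⁻¹≈ε⇒x≈y; x≈y⇒x∙y⁻¹≈ε; ∙-cancelʳ)
  open import Algebra.Properties.AbelianGroup (CommutativeRing.+-abelianGroup ring) using (⁻¹-∙-comm)
  open import Algebra.Solver.Ring.NaturalCoefficients (CommutativeRing.commutativeSemiring ring) (λ _ _ → nothing)
    using (solve; _:+_; _:*_; _:=_)
  open ≡-Reasoning

  data IsNormalised : Triple F → Set where
    [1,_,_] : ∀ y z → IsNormalised (1# , y , z)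
    [0,1,_] : ∀ z → IsNormalised (0# , 1# , z)
    [0,0,1] : IsNormalised (0# , 0# , 1#)

  IsNormalised⇒∈ : ∀ {t} → IsNormalised t → t ∈ normalised F
  IsNormalised⇒∈ [1, y , z ] =
    ∈-++⁺ˡ (∈-map⁺ _ {xs = cartesianProduct (allFin q) (allFin q)} (∈-cartesianProduct⁺ (∈-allFin y) (∈-allFin z)))
  IsNormalised⇒∈ [0,1, z ] =
    ∈-++⁺ʳ (map _ (cartesianProduct (allFin q) (allFin q))) (∈-++⁺ˡ (∈-map⁺ (λ z → 0# , 1# , z) (∈-allFin z)))
  IsNormalised⇒∈ [0,0,1] =
    ∈-++⁺ʳ (map _ (cartesianProduct (allFin q) (allFin q))) (∈-++⁺ʳ (map (λ z → 0# , 1# , z) (allFin q)) (here refl))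

  ∈⇒IsNormalised : ∀ {t} → t ∈ normalised F → IsNormalised t
  ∈⇒IsNormalised t∈ with ∈-++⁻ (map _ (cartesianProduct (allFin q) (allFin q))) t∈
  ... | inj₁ t∈₁ with ∈-map⁻ _ t∈₁
  ...   | (y , z) , _ , refl = [1, y , z ]
  ∈⇒IsNormalised t∈ | inj₂ t∈₂ with ∈-++⁻ (map _ (allFin q)) t∈₂
  ... | inj₁ t∈₃ with ∈-map⁻ _ t∈₃
  ...   | z , _ , refl = [0,1, z ]
  ∈⇒IsNormalised t∈ | inj₂ t∈₂ | inj₂ (here refl) = [0,0,1]

  normalised-unique : Unique (normalised F)
  normalised-unique =
    ++⁺ (map⁺ affine-injective (cartesianProduct⁺ (allFin⁺ q) (allFin⁺ q)))
        (++⁺ (map⁺ (cong (λ t → proj₂ (proj₂ t))) (allFin⁺ q)) ([] ∷ []) at-infinity-disjoint)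
        affine-disjoint
    where
    affine-injective : ∀ {a b : Fin q × Fin q} →
                       _≡_ {A = Triple F} (1# , proj₁ a , proj₂ a) (1# , proj₁ b , proj₂ b) → a ≡ b
    affine-injective refl = refl
    at-infinity-disjoint : ∀ {t} → ¬ (t ∈ map (λ z → 0# , 1# , z) (allFin q) × t ∈ (0# , 0# , 1#) ∷ [])
    at-infinity-disjoint (t∈ , here refl) with ∈-map⁻ _ t∈
    ... | _ , _ , e = 0≢1 (cong (λ t → proj₁ (proj₂ t)) e)
    affine-disjoint : ∀ {t} → ¬ (t ∈ map _ (cartesianProduct (allFin q) (allFin q)) ×
                                 t ∈ map (λ z → 0# , 1# , z) (allFin q) ++ (0# , 0# , 1#) ∷ [])
    affine-disjoint (t∈ , t∈′) with ∈-map⁻ _ t∈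
    ... | _ , _ , refl with ∈-++⁻ (map (λ z → 0# , 1# , z) (allFin q)) t∈′
    ...   | inj₂ (here 1≡0) = 0≢1 (sym (cong proj₁ 1≡0))
    ...   | inj₁ t∈₁ with ∈-map⁻ _ t∈₁
    ...     | _ , _ , 1≡0 = 0≢1 (sym (cong proj₁ 1≡0))

  𝟎 : Triple F
  𝟎 = 0# , 0# , 0#

  infixl 7 _•_ _·_ _⨯_
  infixl 6 _⊖_
  infix  4 _∥_

  _•_ : Fin q → Triple F → Triple F
  c • (x , y , z) = c * x , c * y , c * z

  _⊖_ : Triple F → Triple F → Triple F
  (a₁ , a₂ , a₃) ⊖ (b₁ , b₂ , b₃) = a₁ - b₁ , a₂ - b₂ , a₃ - b₃

  _·_ : Triple F → Triple F → Fin q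
  (a₁ , a₂ , a₃) · (x₁ , x₂ , x₃) = a₁ * x₁ + a₂ * x₂ + a₃ * x₃

  -- The solver used here handles commutative semirings only, so _⨯_ is a difference a ⊖ b of two
  -- negation-free vectors, and ⊖-· pulls the subtraction out of each identity about it.
  _⨯_ : Triple F → Triple F → Triple F
  (x₁ , x₂ , x₃) ⨯ (z₁ , z₂ , z₃) = (x₂ * z₃ , x₃ * z₁ , x₁ * z₂) ⊖ (x₃ * z₂ , x₁ * z₃ , x₂ * z₁)

  _∥_ : Triple F → Triple F → Set
  (u₁ , u₂ , u₃) ∥ (v₁ , v₂ , v₃) = (u₂ * v₃ ≡ u₃ * v₂) × (u₃ * v₁ ≡ u₁ * v₃) × (u₁ * v₂ ≡ u₂ * v₁)

  private
    -‿+-+-+ : ∀ a₁ a₂ a₃ b₁ b₂ b₃ → (a₁ - b₁) + (a₂ - b₂) + (a₃ - b₃) ≡ (a₁ + a₂ + a₃) - (b₁ + b₂ + b₃)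
    -‿+-+-+ a₁ a₂ a₃ b₁ b₂ b₃ = begin
      (a₁ - b₁) + (a₂ - b₂) + (a₃ - b₃)           ≡⟨ regroup a₁ a₂ a₃ (- b₁) (- b₂) (- b₃) ⟩
      (a₁ + a₂ + a₃) + ((- b₁ + - b₂) + - b₃)     ≡⟨ cong (λ t → (a₁ + a₂ + a₃) + (t + - b₃)) (⁻¹-∙-comm b₁ b₂) ⟩
      (a₁ + a₂ + a₃) + (- (b₁ + b₂) + - b₃)       ≡⟨ cong ((a₁ + a₂ + a₃) +_) (⁻¹-∙-comm (b₁ + b₂) b₃) ⟩
      (a₁ + a₂ + a₃) - (b₁ + b₂ + b₃)             ∎
      where
      regroup : ∀ a₁ a₂ a₃ n₁ n₂ n₃ → (a₁ + n₁) + (a₂ + n₂) + (a₃ + n₃) ≡ (a₁ + a₂ + a₃) + ((n₁ + n₂) + n₃)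
      regroup = solve 6 (λ a₁ a₂ a₃ n₁ n₂ n₃ →
        (a₁ :+ n₁) :+ (a₂ :+ n₂) :+ (a₃ :+ n₃) := (a₁ :+ a₂ :+ a₃) :+ ((n₁ :+ n₂) :+ n₃)) refl

    -‿cancel : ∀ x y w → (x - y) + (y + w) ≡ x + w
    -‿cancel x y w = begin
      (x + - y) + (y + w) ≡⟨ regroup x w y (- y) ⟩
      (x + w) + (- y + y) ≡⟨ cong ((x + w) +_) (-‿inverseˡ y) ⟩
      (x + w) + 0#        ≡⟨ +-identityʳ (x + w) ⟩
      x + w               ∎
      where
      regroup : ∀ x w y n → (x + n) + (y + w) ≡ (x + w) + (n + y)
      regroup = solve 4 (λ x w y n → (x :+ n) :+ (y :+ w) := (x :+ w) :+ (n :+ y)) refl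

    +≡+⇒-≡- : ∀ {x y u v} → x + v ≡ u + y → x - y ≡ u - v
    +≡+⇒-≡- {x} {y} {u} {v} x+v≡u+y = ∙-cancelʳ (y + v) (x - y) (u - v) (begin
      (x - y) + (y + v) ≡⟨ -‿cancel x y v ⟩
      x + v             ≡⟨ x+v≡u+y ⟩
      u + y             ≡⟨ -‿cancel u v y ⟨
      (u - v) + (v + y) ≡⟨ cong ((u - v) +_) (+-comm v y) ⟩
      (u - v) + (y + v) ∎)

  ⊖-· : ∀ a b u → (a ⊖ b) · u ≡ a · u - b · u
  ⊖-· (a₁ , a₂ , a₃) (b₁ , b₂ , b₃) (u₁ , u₂ , u₃) =
    trans (cong₂ _+_ (cong₂ _+_ ([y-z]x≈yx-zx u₁ a₁ b₁) ([y-z]x≈yx-zx u₂ a₂ b₂)) ([y-z]x≈yx-zx u₃ a₃ b₃))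
          (-‿+-+-+ _ _ _ _ _ _)

  ⨯-incidentˡ : ∀ x z → Incident F (x ⨯ z) x
  ⨯-incidentˡ x@(x₁ , x₂ , x₃) z@(z₁ , z₂ , z₃) = trans (⊖-· _ _ x) (x≈y⇒x∙y⁻¹≈ε (expand x₁ x₂ x₃ z₁ z₂ z₃))
    where
    expand : ∀ x₁ x₂ x₃ z₁ z₂ z₃ →
      x₂ * z₃ * x₁ + x₃ * z₁ * x₂ + x₁ * z₂ * x₃ ≡ x₃ * z₂ * x₁ + x₁ * z₃ * x₂ + x₂ * z₁ * x₃
    expand = solve 6 (λ x₁ x₂ x₃ z₁ z₂ z₃ →
      x₂ :* z₃ :* x₁ :+ x₃ :* z₁ :* x₂ :+ x₁ :* z₂ :* x₃ := x₃ :* z₂ :* x₁ :+ x₁ :* z₃ :* x₂ :+ x₂ :* z₁ :* x₃) refl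

  ⨯-incidentʳ : ∀ x z → Incident F (x ⨯ z) z
  ⨯-incidentʳ x@(x₁ , x₂ , x₃) z@(z₁ , z₂ , z₃) = trans (⊖-· _ _ z) (x≈y⇒x∙y⁻¹≈ε (expand x₁ x₂ x₃ z₁ z₂ z₃))
    where
    expand : ∀ x₁ x₂ x₃ z₁ z₂ z₃ →
      x₂ * z₃ * z₁ + x₃ * z₁ * z₂ + x₁ * z₂ * z₃ ≡ x₃ * z₂ * z₁ + x₁ * z₃ * z₂ + x₂ * z₁ * z₃
    expand = solve 6 (λ x₁ x₂ x₃ z₁ z₂ z₃ →
      x₂ :* z₃ :* z₁ :+ x₃ :* z₁ :* z₂ :+ x₁ :* z₂ :* z₃ := x₃ :* z₂ :* z₁ :+ x₁ :* z₃ :* z₂ :+ x₂ :* z₁ :* z₃) refl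

  ⨯≡𝟎⇒∥ : ∀ x z → x ⨯ z ≡ 𝟎 → x ∥ z
  ⨯≡𝟎⇒∥ (x₁ , x₂ , x₃) (z₁ , z₂ , z₃) x⨯z≡𝟎 =
    x∙y⁻¹≈ε⇒x≈y _ _ (cong proj₁ x⨯z≡𝟎) ,
    x∙y⁻¹≈ε⇒x≈y _ _ (cong (λ t → proj₁ (proj₂ t)) x⨯z≡𝟎) ,
    x∙y⁻¹≈ε⇒x≈y _ _ (cong (λ t → proj₂ (proj₂ t)) x⨯z≡𝟎)

  private
    ∥⨯-component : ∀ l₁ l₂ l₃ x₁ x₂ x₃ z₁ z₂ z₃ →
      l₁ * x₁ + l₂ * x₂ + l₃ * x₃ ≡ 0# → l₁ * z₁ + l₂ * z₂ + l₃ * z₃ ≡ 0# →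
      l₂ * (x₁ * z₂ - x₂ * z₁) ≡ l₃ * (x₃ * z₁ - x₁ * z₃)
    ∥⨯-component l₁ l₂ l₃ x₁ x₂ x₃ z₁ z₂ z₃ ℓ·x≡0 ℓ·z≡0 = begin
      l₂ * (x₁ * z₂ - x₂ * z₁)                ≡⟨ x[y-z]≈xy-xz l₂ _ _ ⟩
      l₂ * (x₁ * z₂) - l₂ * (x₂ * z₁)         ≡⟨ +≡+⇒-≡- (∙-cancelʳ (l₁ * (x₁ * z₁)) _ _ (trans both-x₁ (sym both-z₁))) ⟩
      l₃ * (x₃ * z₁) - l₃ * (x₁ * z₃)         ≡⟨ x[y-z]≈xy-xz l₃ _ _ ⟨
      l₃ * (x₃ * z₁ - x₁ * z₃)                ∎
      where
      both-x₁ : l₂ * (x₁ * z₂) + l₃ * (x₁ * z₃) + l₁ * (x₁ * z₁) ≡ 0#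
      both-x₁ = trans (solve 7 (λ l₁ l₂ l₃ x₁ z₁ z₂ z₃ →
                  l₂ :* (x₁ :* z₂) :+ l₃ :* (x₁ :* z₃) :+ l₁ :* (x₁ :* z₁) := x₁ :* (l₁ :* z₁ :+ l₂ :* z₂ :+ l₃ :* z₃))
                  refl l₁ l₂ l₃ x₁ z₁ z₂ z₃)
                (trans (cong (x₁ *_) ℓ·z≡0) (zeroʳ x₁))
      both-z₁ : l₃ * (x₃ * z₁) + l₂ * (x₂ * z₁) + l₁ * (x₁ * z₁) ≡ 0#
      both-z₁ = trans (solve 7 (λ l₁ l₂ l₃ x₁ x₂ x₃ z₁ →
                  l₃ :* (x₃ :* z₁) :+ l₂ :* (x₂ :* z₁) :+ l₁ :* (x₁ :* z₁) := z₁ :* (l₁ :* x₁ :+ l₂ :* x₂ :+ l₃ :* x₃))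
                  refl l₁ l₂ l₃ x₁ x₂ x₃ z₁)
                (trans (cong (z₁ *_) ℓ·x≡0) (zeroʳ z₁))

    rotate : ∀ a b c → a + b + c ≡ b + c + a
    rotate = solve 3 (λ a b c → a :+ b :+ c := b :+ c :+ a) refl

  incident⇒∥⨯ : ∀ ℓ x z → Incident F ℓ x → Incident F ℓ z → ℓ ∥ x ⨯ z
  incident⇒∥⨯ (l₁ , l₂ , l₃) (x₁ , x₂ , x₃) (z₁ , z₂ , z₃) ℓ·x≡0 ℓ·z≡0 =
    ∥⨯-component l₁ l₂ l₃ x₁ x₂ x₃ z₁ z₂ z₃ ℓ·x≡0 ℓ·z≡0 ,
    ∥⨯-component l₂ l₃ l₁ x₂ x₃ x₁ z₂ z₃ z₁ (trans (sym (rotate _ _ _)) ℓ·x≡0) (trans (sym (rotate _ _ _)) ℓ·z≡0) ,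
    ∥⨯-component l₃ l₁ l₂ x₃ x₁ x₂ z₃ z₁ z₂ (trans (sym (rotate _ _ _)) (trans (sym (rotate _ _ _)) ℓ·x≡0))
                                            (trans (sym (rotate _ _ _)) (trans (sym (rotate _ _ _)) ℓ·z≡0))

  •-incident : ∀ c ℓ p → Incident F ℓ p → Incident F (c • ℓ) p
  •-incident c (a , b , d) (x , y , z) ℓ·p≡0 = begin
    c * a * x + c * b * y + c * d * z ≡⟨ factor c a b d x y z ⟩
    c * (a * x + b * y + d * z)       ≡⟨ cong (c *_) ℓ·p≡0 ⟩
    c * 0#                            ≡⟨ zeroʳ c ⟩
    0#                                ∎
    where
    factor : ∀ c a b d x y z → c * a * x + c * b * y + c * d * z ≡ c * (a * x + b * y + d * z)
    factor = solve 7 (λ c a b d x y z →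
      c :* a :* x :+ c :* b :* y :+ c :* d :* z := c :* (a :* x :+ b :* y :+ d :* z)) refl

  ∥-•ʳ : ∀ c u v → u ∥ v → u ∥ c • v
  ∥-•ʳ c (u₁ , u₂ , u₃) (v₁ , v₂ , v₃) (e₁ , e₂ , e₃) = scaled e₁ , scaled e₂ , scaled e₃
    where
    pull : ∀ a b → a * (c * b) ≡ c * (a * b)
    pull = solve 3 (λ c a b → a :* (c :* b) := c :* (a :* b)) refl c
    scaled : ∀ {a b a′ b′} → a * b ≡ a′ * b′ → a * (c * b) ≡ a′ * (c * b′)
    scaled {a} {b} {a′} {b′} e = trans (pull a b) (trans (cong (c *_) e) (sym (pull a′ b′)))

  normalise : ∀ w → w ≢ 𝟎 → ∃ λ c → IsNormalised (c • w)
  normalise (w₁ , w₂ , w₃) w≢𝟎 with w₁ Fin.≟ 0#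
  ... | no w₁≢0 with inverse w₁ w₁≢0
  ...   | c , w₁c≡1 = c , subst (λ a → IsNormalised (a , c * w₂ , c * w₃))
                                (sym (trans (*-comm c w₁) w₁c≡1)) [1, _ , _ ]
  normalise (w₁ , w₂ , w₃) w≢𝟎 | yes refl with w₂ Fin.≟ 0#
  ... | no w₂≢0 with inverse w₂ w₂≢0
  ...   | c , w₂c≡1 = c , subst₂ (λ a b → IsNormalised (a , b , c * w₃))
                                 (sym (zeroʳ c)) (sym (trans (*-comm c w₂) w₂c≡1)) [0,1, _ ]
  normalise (w₁ , w₂ , w₃) w≢𝟎 | yes refl | yes refl with w₃ Fin.≟ 0#
  ... | yes refl = ⊥-elim (w≢𝟎 refl)
  ... | no w₃≢0 with inverse w₃ w₃≢0
  ...   | c , w₃c≡1 = c , subst (λ b → IsNormalised (c * 0# , c * 0# , b)) (sym (trans (*-comm c w₃) w₃c≡1))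
                              (subst (λ a → IsNormalised (a , a , 1#)) (sym (zeroʳ c)) [0,0,1])

  private
    *1≡1*⇒≡ : ∀ {a b} → a * 1# ≡ 1# * b → a ≡ b
    *1≡1*⇒≡ {a} {b} e = trans (sym (*-identityʳ a)) (trans e (*-identityˡ b))

    *0≢1*1 : ∀ {a} → a * 0# ≢ 1# * 1#
    *0≢1*1 {a} e = 0≢1 (trans (sym (zeroʳ a)) (trans e (*-identityˡ 1#)))

    0*≢1*1 : ∀ {a} → 0# * a ≢ 1# * 1#
    0*≢1*1 {a} e = 0≢1 (trans (sym (zeroˡ a)) (trans e (*-identityˡ 1#)))

  IsNormalised-∥⇒≡ : ∀ {u v} → IsNormalised u → IsNormalised v → u ∥ v → u ≡ v
  IsNormalised-∥⇒≡ [1, y , z ] [1, y′ , z′ ] (_ , e₂ , e₃)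
    rewrite *1≡1*⇒≡ e₂ | *1≡1*⇒≡ (sym e₃)     = refl
  IsNormalised-∥⇒≡ [1, y , z ] [0,1, z′ ] (_ , _ , e₃)  = ⊥-elim (*0≢1*1 (sym e₃))
  IsNormalised-∥⇒≡ [1, y , z ] [0,0,1]    (_ , e₂ , _)  = ⊥-elim (*0≢1*1 e₂)
  IsNormalised-∥⇒≡ [0,1, z ]   [1, y′ , z′ ] (_ , _ , e₃) = ⊥-elim (0*≢1*1 e₃)
  IsNormalised-∥⇒≡ [0,1, z ]   [0,1, z′ ] (e₁ , _ , _)
    rewrite *1≡1*⇒≡ (sym e₁)                  = refl
  IsNormalised-∥⇒≡ [0,1, z ]   [0,0,1]    (e₁ , _ , _)  = ⊥-elim (*0≢1*1 (sym e₁))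
  IsNormalised-∥⇒≡ [0,0,1]     [1, y′ , z′ ] (_ , e₂ , _) = ⊥-elim (0*≢1*1 (sym e₂))
  IsNormalised-∥⇒≡ [0,0,1]     [0,1, z′ ] (e₁ , _ , _)  = ⊥-elim (0*≢1*1 e₁)
  IsNormalised-∥⇒≡ [0,0,1]     [0,0,1]    _             = refl

  incident-sym : ∀ ℓ p → Incident F ℓ p → Incident F p ℓ
  incident-sym (a , b , c) (x , y , z) ℓ·p≡0 =
    trans (cong₂ _+_ (cong₂ _+_ (*-comm x a) (*-comm y b)) (*-comm z c)) ℓ·p≡0

  private
    a+0+0 : ∀ a → a + 0# + 0# ≡ a
    a+0+0 a = trans (+-identityʳ (a + 0#)) (+-identityʳ a)

    0+a+0 : ∀ a → 0# + a + 0# ≡ a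
    0+a+0 a = trans (+-identityʳ (0# + a)) (+-identityˡ a)

    0+0+a : ∀ a → 0# + 0# + a ≡ a
    0+0+a a = trans (cong (_+ a) (+-identityʳ 0#)) (+-identityˡ a)

  [1,y,z]∤[1,0,0] : ∀ y z → ¬ Incident F (1# , y , z) (1# , 0# , 0#)
  [1,y,z]∤[1,0,0] y z e = 0≢1 (trans (sym e) (trans (cong₂ _+_ (cong₂ _+_ (*-identityˡ 1#) (zeroʳ y)) (zeroʳ z)) (a+0+0 1#)))

  [0,1,z]∤[1,1,0] : ∀ z → ¬ Incident F (0# , 1# , z) (1# , 1# , 0#)
  [0,1,z]∤[1,1,0] z e = 0≢1 (trans (sym e) (trans (cong₂ _+_ (cong₂ _+_ (zeroˡ 1#) (*-identityˡ 1#)) (zeroʳ z)) (0+a+0 1#)))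

  [0,0,1]∤[1,0,1] : ¬ Incident F (0# , 0# , 1#) (1# , 0# , 1#)
  [0,0,1]∤[1,0,1] e = 0≢1 (trans (sym e) (trans (cong₂ _+_ (cong₂ _+_ (zeroˡ 1#) (zeroˡ 0#)) (*-identityˡ 1#)) (0+0+a 1#)))

  [0,1,z]∣[1,0,0] : ∀ z → Incident F (0# , 1# , z) (1# , 0# , 0#)
  [0,1,z]∣[1,0,0] z = trans (cong₂ _+_ (cong₂ _+_ (zeroˡ 1#) (zeroʳ 1#)) (zeroʳ z)) (a+0+0 0#)

  [0,0,1]∣[1,0,0] : Incident F (0# , 0# , 1#) (1# , 0# , 0#)
  [0,0,1]∣[1,0,0] = trans (cong₂ _+_ (cong₂ _+_ (zeroˡ 1#) (zeroˡ 0#)) (zeroʳ 1#)) (a+0+0 0#)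

  record Join (x z : Triple F) : Set where
    field
      line      : Triple F
      line∈     : line ∈ normalised F
      through₁  : Incident F line x
      through₂  : Incident F line z
      unique    : ∀ {ℓ} → ℓ ∈ normalised F → Incident F ℓ x → Incident F ℓ z → ℓ ≡ line

  distinct⇒⨯≢𝟎 : ∀ {x z} → x ∈ normalised F → z ∈ normalised F → x ≢ z → x ⨯ z ≢ 𝟎
  distinct⇒⨯≢𝟎 {x} {z} x∈ z∈ x≢z x⨯z≡𝟎 =
    x≢z (IsNormalised-∥⇒≡ (∈⇒IsNormalised x∈) (∈⇒IsNormalised z∈) (⨯≡𝟎⇒∥ x z x⨯z≡𝟎))

  join : ∀ {x z} → x ∈ normalised F → z ∈ normalised F → x ≢ z → Join x z
  join {x} {z} x∈ z∈ x≢z with normalise (x ⨯ z) (distinct⇒⨯≢𝟎 x∈ z∈ x≢z)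
  ... | c , nf = record
    { line     = c • (x ⨯ z)
    ; line∈    = IsNormalised⇒∈ nf
    ; through₁ = •-incident c (x ⨯ z) x (⨯-incidentˡ x z)
    ; through₂ = •-incident c (x ⨯ z) z (⨯-incidentʳ x z)
    ; unique   = λ {ℓ} ℓ∈ ℓx ℓz →
                   IsNormalised-∥⇒≡ (∈⇒IsNormalised ℓ∈) nf (∥-•ʳ c ℓ (x ⨯ z) (incident⇒∥⨯ ℓ x z ℓx ℓz))
    }

open import Data.Nat using (_+_; _*_; _∸_; _≤_; _<_; _≤?_; _≟_; z≤n; s≤s)
open import Data.Nat.Properties
open import Data.Nat.ListAction using (sum)
open import Data.Nat.ListAction.Properties using (sum-++)
open import Data.Nat.Tactic.RingSolver using (solve-∀)
open import Algebra.Properties.CommutativeSemigroup +-commutativeSemigroup using (interchange)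
open import Algebra.Properties.CommutativeSemigroup *-commutativeSemigroup using (x∙yz≈y∙xz; x∙yz≈z∙xy)

-- Finite sums over lists

private variable
  A B P Q : Set

∑ : List A → (A → ℕ) → ℕ
∑ xs f = sum (map f xs)

syntax ∑ xs (λ x → e) = ∑[ x ∈ xs ] e

∑-cong : ∀ (xs : List A) {f g : A → ℕ} → (∀ {x} → x ∈ xs → f x ≡ g x) → ∑ xs f ≡ ∑ xs g
∑-cong []       f≡g = refl
∑-cong (x ∷ xs) f≡g = cong₂ _+_ (f≡g (here refl)) (∑-cong xs (λ x∈ → f≡g (there x∈)))

∑-mono-≤ : ∀ (xs : List A) {f g : A → ℕ} → (∀ {x} → x ∈ xs → f x ≤ g x) → ∑ xs f ≤ ∑ xs g
∑-mono-≤ []       f≤g = z≤n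
∑-mono-≤ (x ∷ xs) f≤g = +-mono-≤ (f≤g (here refl)) (∑-mono-≤ xs (λ x∈ → f≤g (there x∈)))

∑-+ : ∀ (xs : List A) (f g : A → ℕ) → ∑[ x ∈ xs ] (f x + g x) ≡ ∑ xs f + ∑ xs g
∑-+ []       f g = refl
∑-+ (x ∷ xs) f g = trans (cong (f x + g x +_) (∑-+ xs f g)) (interchange (f x) (g x) (∑ xs f) (∑ xs g))

∑-*ˡ : ∀ (xs : List A) c (f : A → ℕ) → ∑[ x ∈ xs ] (c * f x) ≡ c * ∑ xs f
∑-*ˡ []       c f = sym (*-zeroʳ c)
∑-*ˡ (x ∷ xs) c f = trans (cong (c * f x +_) (∑-*ˡ xs c f)) (sym (*-distribˡ-+ c (f x) (∑ xs f)))

∑-*ʳ : ∀ (xs : List A) c (f : A → ℕ) → ∑[ x ∈ xs ] (f x * c) ≡ ∑ xs f * c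
∑-*ʳ xs c f = begin
  ∑[ x ∈ xs ] (f x * c) ≡⟨ ∑-cong xs (λ {x} _ → *-comm (f x) c) ⟩
  ∑[ x ∈ xs ] (c * f x) ≡⟨ ∑-*ˡ xs c f ⟩
  c * ∑ xs f            ≡⟨ *-comm c (∑ xs f) ⟩
  ∑ xs f * c            ∎
  where open ≡-Reasoning

∑-const : ∀ (xs : List A) c → ∑[ _ ∈ xs ] c ≡ length xs * c
∑-const []       c = refl
∑-const (x ∷ xs) c = cong (c +_) (∑-const xs c)

∑-zero : ∀ (xs : List A) → ∑[ _ ∈ xs ] 0 ≡ 0
∑-zero xs = trans (∑-const xs 0) (*-zeroʳ (length xs))

∑-swap : ∀ (xs : List A) (ys : List B) (f : A → B → ℕ) →
         ∑[ x ∈ xs ] ∑[ y ∈ ys ] f x y ≡ ∑[ y ∈ ys ] ∑[ x ∈ xs ] f x y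
∑-swap []       ys f = sym (∑-zero ys)
∑-swap (x ∷ xs) ys f = begin
  ∑ ys (f x) + ∑[ x ∈ xs ] ∑ ys (f x)          ≡⟨ cong (∑ ys (f x) +_) (∑-swap xs ys f) ⟩
  ∑ ys (f x) + ∑[ y ∈ ys ] ∑[ x ∈ xs ] f x y  ≡⟨ ∑-+ ys (f x) (λ y → ∑[ x ∈ xs ] f x y) ⟨
  ∑[ y ∈ ys ] (f x y + ∑[ x ∈ xs ] f x y)     ∎
  where open ≡-Reasoning

∑-++ : ∀ (xs ys : List A) (f : A → ℕ) → ∑ (xs ++ ys) f ≡ ∑ xs f + ∑ ys f
∑-++ xs ys f = trans (cong sum (map-++ f xs ys)) (sum-++ (map f xs) (map f ys))

∑-map : ∀ (g : B → A) (xs : List B) (f : A → ℕ) → ∑ (map g xs) f ≡ ∑[ x ∈ xs ] f (g x)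
∑-map g []       f = refl
∑-map g (x ∷ xs) f = cong (f (g x) +_) (∑-map g xs f)

∑-cartesianProduct : ∀ (xs : List A) (ys : List B) (f : A × B → ℕ) →
                     ∑ (cartesianProduct xs ys) f ≡ ∑[ x ∈ xs ] ∑[ y ∈ ys ] f (x , y)
∑-cartesianProduct []       ys f = refl
∑-cartesianProduct (x ∷ xs) ys f = begin
  ∑ (map (x ,_) ys ++ cartesianProduct xs ys) f             ≡⟨ ∑-++ (map (x ,_) ys) _ f ⟩
  ∑ (map (x ,_) ys) f + ∑ (cartesianProduct xs ys) f       ≡⟨ cong₂ _+_ (∑-map (x ,_) ys f) (∑-cartesianProduct xs ys f) ⟩
  ∑[ y ∈ ys ] f (x , y) + ∑[ x ∈ xs ] ∑[ y ∈ ys ] f (x , y) ∎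
  where open ≡-Reasoning

∈⇒≤∑ : ∀ {xs : List A} {x} (f : A → ℕ) → x ∈ xs → f x ≤ ∑ xs f
∈⇒≤∑ {xs = y ∷ xs} f (here refl) = m≤m+n (f y) (∑ xs f)
∈⇒≤∑ {xs = y ∷ xs} f (there x∈) = ≤-trans (∈⇒≤∑ f x∈) (m≤n+m (∑ xs f) (f y))

𝟙 : Dec P → ℕ
𝟙 (yes _) = 1
𝟙 (no _)  = 0

𝟙-yes : (d : Dec P) → P → 𝟙 d ≡ 1
𝟙-yes (yes _) _ = refl
𝟙-yes (no ¬p) p = ⊥-elim (¬p p)

𝟙-no : (d : Dec P) → ¬ P → 𝟙 d ≡ 0
𝟙-no (yes p) ¬p = ⊥-elim (¬p p)
𝟙-no (no _)  _  = refl

𝟙-+-𝟙¬ : (d : Dec P) → 𝟙 d + 𝟙 (¬? d) ≡ 1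
𝟙-+-𝟙¬ (yes _) = refl
𝟙-+-𝟙¬ (no _)  = refl

𝟙-idem : (d : Dec P) → 𝟙 d * 𝟙 d ≡ 𝟙 d
𝟙-idem (yes _) = refl
𝟙-idem (no _)  = refl

𝟙-*-≤ : (d : Dec P) (n : ℕ) → 𝟙 d * n ≤ n
𝟙-*-≤ (yes _) n = ≤-reflexive (+-identityʳ n)
𝟙-*-≤ (no _)  n = z≤n

𝟙-*-if : (d : Dec P) {n : ℕ} → (P → n ≡ 1) → 𝟙 d * n ≡ 𝟙 d
𝟙-*-if (yes p) n≡1 = trans (+-identityʳ _) (n≡1 p)
𝟙-*-if (no _)  _   = refl

𝟙-*-𝟙-⇒ : (Q → P) → (d : Dec P) (e : Dec Q) → 𝟙 d * 𝟙 e ≡ 𝟙 e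
𝟙-*-𝟙-⇒ Q⇒P d (yes q) = trans (*-identityʳ (𝟙 d)) (𝟙-yes d (Q⇒P q))
𝟙-*-𝟙-⇒ Q⇒P d (no _)  = *-zeroʳ (𝟙 d)

𝟙-cong : (P → Q) → (Q → P) → (d : Dec P) (e : Dec Q) → 𝟙 d ≡ 𝟙 e
𝟙-cong P⇒Q Q⇒P (yes p) e = sym (𝟙-yes e (P⇒Q p))
𝟙-cong P⇒Q Q⇒P (no ¬p) e = sym (𝟙-no e (λ q → ¬p (Q⇒P q)))

𝟙-*-𝟙 : (d : Dec P) (e : Dec Q) → 𝟙 d * 𝟙 e ≡ 𝟙 (d ×-dec e)
𝟙-*-𝟙 (yes _) (yes _) = refl
𝟙-*-𝟙 (yes _) (no _)  = refl
𝟙-*-𝟙 (no _)  (yes _) = refl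
𝟙-*-𝟙 (no _)  (no _)  = refl

module _ {R : A → Set} (R? : Decidable R) where

  length-filter : ∀ xs → length (filter R? xs) ≡ ∑[ x ∈ xs ] 𝟙 (R? x)
  length-filter []       = refl
  length-filter (x ∷ xs) with R? x
  ... | yes _ = cong suc (length-filter xs)
  ... | no _  = length-filter xs

  ∑-filter : ∀ xs (f : A → ℕ) → ∑ (filter R? xs) f ≡ ∑[ x ∈ xs ] (𝟙 (R? x) * f x)
  ∑-filter []       f = refl
  ∑-filter (x ∷ xs) f with R? x
  ... | yes _ = cong₂ _+_ (sym (+-identityʳ (f x))) (∑-filter xs f)
  ... | no _  = ∑-filter xs f

module _ (_≟_ : DecidableEquality A) where

  open import Data.List.Membership.DecPropositional _≟_ using (_∈?_)

  ∑-δ : ∀ {xs} → Unique xs → ∀ {a} → a ∈ xs → (f : A → ℕ) → ∑[ x ∈ xs ] (𝟙 (x ≟ a) * f x) ≡ f a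
  ∑-δ {y ∷ xs} (y∉xs ∷ _) (here refl) f = begin
    𝟙 (y ≟ y) * f y + ∑[ x ∈ xs ] (𝟙 (x ≟ y) * f x)
      ≡⟨ cong₂ _+_ (cong (_* f y) (𝟙-yes (y ≟ y) refl)) (∑-cong xs off-y) ⟩
    1 * f y + ∑[ _ ∈ xs ] 0
      ≡⟨ cong₂ _+_ (+-identityʳ (f y)) (∑-zero xs) ⟩
    f y + 0
      ≡⟨ +-identityʳ (f y) ⟩
    f y ∎
    where
    open ≡-Reasoning
    off-y : ∀ {x} → x ∈ xs → 𝟙 (x ≟ y) * f x ≡ 0
    off-y x∈ = cong (_* _) (𝟙-no (_ ≟ y) (λ x≡y → All.lookup y∉xs x∈ (sym x≡y)))
  ∑-δ {y ∷ xs} (y∉xs ∷ u) {a} (there a∈) f with y ≟ a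
  ... | yes refl = ⊥-elim (All.lookup y∉xs a∈ refl)
  ... | no _     = ∑-δ u a∈ f

  ∑-𝟙-unique : ∀ {R : A → Set} (R? : Decidable R) {xs} → Unique xs → ∀ {a} → a ∈ xs → R a →
               (∀ {b} → b ∈ xs → R b → b ≡ a) → ∑[ x ∈ xs ] 𝟙 (R? x) ≡ 1
  ∑-𝟙-unique {R} R? {xs} u a∈ Ra unique = trans (∑-cong xs 𝟙R≡δ) (∑-δ u a∈ (λ _ → 1))
    where
    𝟙R≡δ : ∀ {x} → x ∈ xs → 𝟙 (R? x) ≡ 𝟙 (x ≟ _) * 1
    𝟙R≡δ {x} x∈ = trans (𝟙-cong (unique x∈) (λ { refl → Ra }) (R? x) (x ≟ _)) (sym (*-identityʳ _))

  ∑-split : ∀ {xs} → Unique xs → ∀ {a} → a ∈ xs → (f : A → ℕ) →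
            ∑ xs f ≡ f a + ∑[ x ∈ xs ] (𝟙 (¬? (x ≟ a)) * f x)
  ∑-split {xs} u {a} a∈ f = begin
    ∑ xs f
      ≡⟨ ∑-cong xs (λ {x} _ → either-or x) ⟨
    ∑[ x ∈ xs ] (𝟙 (x ≟ a) * f x + 𝟙 (¬? (x ≟ a)) * f x)
      ≡⟨ ∑-+ xs _ _ ⟩
    ∑[ x ∈ xs ] (𝟙 (x ≟ a) * f x) + ∑[ x ∈ xs ] (𝟙 (¬? (x ≟ a)) * f x)
      ≡⟨ cong (_+ ∑[ x ∈ xs ] (𝟙 (¬? (x ≟ a)) * f x)) (∑-δ u a∈ f) ⟩
    f a + ∑[ x ∈ xs ] (𝟙 (¬? (x ≟ a)) * f x) ∎
    where
    open ≡-Reasoning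
    either-or : ∀ x → 𝟙 (x ≟ a) * f x + 𝟙 (¬? (x ≟ a)) * f x ≡ f x
    either-or x = begin
      𝟙 (x ≟ a) * f x + 𝟙 (¬? (x ≟ a)) * f x ≡⟨ *-distribʳ-+ (f x) (𝟙 (x ≟ a)) _ ⟨
      (𝟙 (x ≟ a) + 𝟙 (¬? (x ≟ a))) * f x     ≡⟨ cong (_* f x) (𝟙-+-𝟙¬ (x ≟ a)) ⟩
      1 * f x                                ≡⟨ +-identityʳ (f x) ⟩
      f x                                    ∎

  private
    𝟙-∈-∷ : ∀ {y ys} → y ∉ ys → ∀ x → 𝟙 (x ∈? y ∷ ys) ≡ 𝟙 (x ≟ y) + 𝟙 (x ∈? ys)
    𝟙-∈-∷ {y} {ys} y∉ys x with x ≟ y | x ∈? ys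
    ... | yes refl | yes x∈ = ⊥-elim (y∉ys x∈)
    ... | yes refl | no _   = refl
    ... | no _     | yes _  = refl
    ... | no _     | no _   = refl

  ∑-restrict : ∀ {xs ys} → Unique xs → Unique ys → All (_∈ xs) ys → (f : A → ℕ) →
               ∑[ x ∈ xs ] (𝟙 (x ∈? ys) * f x) ≡ ∑ ys f
  ∑-restrict {xs} {[]}     _  _              _            f = ∑-zero xs
  ∑-restrict {xs} {y ∷ ys} ux uy∷ys@(_ ∷ uys) (y∈xs ∷ ys⊆xs) f = begin
    ∑[ x ∈ xs ] (𝟙 (x ∈? y ∷ ys) * f x)
      ≡⟨ ∑-cong xs (λ {x} _ → cong (_* f x) (𝟙-∈-∷ (Unique[x∷xs]⇒x∉xs uy∷ys) x)) ⟩
    ∑[ x ∈ xs ] ((𝟙 (x ≟ y) + 𝟙 (x ∈? ys)) * f x)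
      ≡⟨ ∑-cong xs (λ {x} _ → *-distribʳ-+ (f x) (𝟙 (x ≟ y)) (𝟙 (x ∈? ys))) ⟩
    ∑[ x ∈ xs ] (𝟙 (x ≟ y) * f x + 𝟙 (x ∈? ys) * f x)
      ≡⟨ ∑-+ xs _ _ ⟩
    ∑[ x ∈ xs ] (𝟙 (x ≟ y) * f x) + ∑[ x ∈ xs ] (𝟙 (x ∈? ys) * f x)
      ≡⟨ cong₂ _+_ (∑-δ ux y∈xs f) (∑-restrict ux uys ys⊆xs f) ⟩
    f y + ∑ ys f ∎
    where open ≡-Reasoning

  length≤∑ : ∀ {xs ys} → Unique xs → Unique ys → All (_∈ xs) ys → (f : A → ℕ) →
             All (λ y → 1 ≤ f y) ys → length ys ≤ ∑ xs f
  length≤∑ {xs} {ys} ux uys ys⊆xs f f≥1 = begin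
    length ys                      ≡⟨ *-identityʳ (length ys) ⟨
    length ys * 1                  ≡⟨ ∑-const ys 1 ⟨
    ∑[ _ ∈ ys ] 1                  ≤⟨ ∑-mono-≤ ys (All.lookup f≥1) ⟩
    ∑ ys f                         ≡⟨ ∑-restrict ux uys ys⊆xs f ⟨
    ∑[ x ∈ xs ] (𝟙 (x ∈? ys) * f x) ≤⟨ ∑-mono-≤ xs (λ {x} _ → 𝟙-*-≤ (x ∈? ys) (f x)) ⟩
    ∑ xs f                         ∎
    where open ≤-Reasoning
-- Arithmetic

private
  excess-absurd : ∀ {x y} k → x ≡ y + suc k → ¬ x ≤ y
  excess-absurd {y = y} k refl = m+1+n≰m y

2q∸2≤u⇒2q≤u+2 : ∀ q u → 2 * q ∸ 2 ≤ u → 2 * q ≤ u + 2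
2q∸2≤u⇒2q≤u+2 q u lo = ≤-trans (m≤n+m∸n (2 * q) 2) (≤-trans (+-monoʳ-≤ 2 lo) (≤-reflexive (+-comm 2 u)))

u≤3q∸10⇒u+10≤3q : ∀ q u → 8 ≤ q → u ≤ 3 * q ∸ 10 → u + 10 ≤ 3 * q
u≤3q∸10⇒u+10≤3q q u 8≤q hi = m≤o∸n⇒m+n≤o u (≤-trans (m≤m+n 10 14) (*-monoʳ-≤ 3 8≤q)) hi

few-points-arith : ∀ q u → 3 * (q * q + q + 1) + suc q * (suc q + q) ≤ 4 * (suc q * suc q) + 3 * u →
                   q * q ≤ 3 * u + 2 * q
few-points-arith q u bound = +-cancelʳ-≤ K (q * q) (3 * u + 2 * q) (begin
  q * q + K                                   ≡⟨ lhs q ⟨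
  3 * (q * q + q + 1) + suc q * (suc q + q)   ≤⟨ bound ⟩
  4 * (suc q * suc q) + 3 * u                 ≡⟨ rhs q u ⟩
  3 * u + 2 * q + K                           ∎)
  where
  open ≤-Reasoning
  K : ℕ
  K = 4 * (q * q) + 6 * q + 4
  lhs : ∀ q → 3 * (q * q + q + 1) + suc q * (suc q + q) ≡ q * q + (4 * (q * q) + 6 * q + 4)
  lhs = solve-∀
  rhs : ∀ q u → 4 * (suc q * suc q) + 3 * u ≡ 3 * u + 2 * q + (4 * (q * q) + 6 * q + 4)
  rhs = solve-∀

-- q² + 30 ≤ 11q would mean (q − 5)(q − 6) ≤ 0.
few-points-excluded : ∀ q u → 8 ≤ q → q * q ≤ 3 * u + 2 * q → ¬ (u + 10 ≤ 3 * q)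
few-points-excluded q u 8≤q sq hi with m≤n⇒∃[o]m+o≡n 8≤q
... | t , refl = excess-absurd (5 + 5 * t + t * t) (excess t) (begin
  (8 + t) * (8 + t) + 30       ≤⟨ +-monoˡ-≤ 30 sq ⟩
  3 * u + 2 * (8 + t) + 30     ≡⟨ regroup u (8 + t) ⟩
  3 * (u + 10) + 2 * (8 + t)   ≤⟨ +-monoˡ-≤ (2 * (8 + t)) (*-monoʳ-≤ 3 hi) ⟩
  3 * (3 * (8 + t)) + 2 * (8 + t) ≡⟨ eleven (8 + t) ⟩
  11 * (8 + t)                 ∎)
  where
  open ≤-Reasoning
  excess : ∀ t → (8 + t) * (8 + t) + 30 ≡ 11 * (8 + t) + suc (5 + 5 * t + t * t)
  excess = solve-∀
  regroup : ∀ u q → 3 * u + 2 * q + 30 ≡ 3 * (u + 10) + 2 * q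
  regroup = solve-∀
  eleven : ∀ q → 3 * (3 * q) + 2 * q ≡ 11 * q
  eleven = solve-∀

none-missing-arith : ∀ q n → n ≡ suc q → 4 ≤ n → 3 ≤ 2 * q
none-missing-arith q n refl (s≤s 3≤q) = ≤-trans 3≤q (m≤m+n q (q + 0))

one-missing-arith : ∀ q n e → 1 + n ≡ suc q → 4 ≤ n → e + 2 ≤ suc q → e + 3 ≤ 2 * q
one-missing-arith q n e refl 4≤n e+2≤ = begin
  e + 3          ≡⟨ +-assoc e 2 1 ⟨
  e + 2 + 1      ≤⟨ +-monoˡ-≤ 1 e+2≤ ⟩
  suc n + 1      ≡⟨ +-comm (suc n) 1 ⟩
  2 + n          ≤⟨ +-monoˡ-≤ n (≤-trans (s≤s (s≤s z≤n)) 4≤n) ⟩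
  n + n          ≡⟨ cong (n +_) (+-identityʳ n) ⟨
  2 * n          ∎
  where open ≤-Reasoning

two-missing-arith : ∀ q e → e + 5 ≤ 2 * suc q → e + 3 ≤ 2 * q
two-missing-arith q e bound = +-cancelʳ-≤ 2 (e + 3) (2 * q) (begin
  e + 3 + 2      ≡⟨ +-assoc e 3 2 ⟩
  e + 5          ≤⟨ bound ⟩
  2 * suc q      ≡⟨ *-suc 2 q ⟩
  2 + 2 * q      ≡⟨ +-comm 2 (2 * q) ⟩
  2 * q + 2      ∎)
  where open ≤-Reasoning

private
  shape : ∀ a b → (3 + a) + (4 + b) ≡ suc (6 + a + b)
  shape = solve-∀

-- With q = m + n − 1: m(n − 1) − 3(q − 3) = (m − 3)(n − 4) ≥ 0.
many-missing-arith : ∀ q m n u → m + n ≡ suc q → 3 ≤ m → 4 ≤ n → m * n ≤ u + m → 3 * q ≤ u + 9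
many-missing-arith q m n u m+n≡ 3≤m 4≤n lower with m≤n⇒∃[o]m+o≡n 3≤m | m≤n⇒∃[o]m+o≡n 4≤n
... | a , refl | b , refl with suc-injective (trans (sym m+n≡) (shape a b))
... | refl = +-cancelʳ-≤ (3 + a) (3 * (6 + a + b)) (u + 9) (begin
  3 * (6 + a + b) + (3 + a)               ≤⟨ m≤m+n _ (a * b) ⟩
  3 * (6 + a + b) + (3 + a) + a * b       ≡⟨ expand a b ⟩
  (3 + a) * (4 + b) + 9                   ≤⟨ +-monoˡ-≤ 9 lower ⟩
  u + (3 + a) + 9                         ≡⟨ swap u (3 + a) ⟩
  u + 9 + (3 + a)                         ∎)
  where
  open ≤-Reasoning
  expand : ∀ a b → 3 * (6 + a + b) + (3 + a) + a * b ≡ (3 + a) * (4 + b) + 9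
  expand = solve-∀
  swap : ∀ u m → u + m + 9 ≡ u + 9 + m
  swap = solve-∀

dichotomy-excluded : ∀ q u → 2 * q ≤ u + 2 → u + 10 ≤ 3 * q → ¬ (u + 3 ≤ 2 * q ⊎ 3 * q ≤ u + 9)
dichotomy-excluded q u lo hi (inj₁ small) = m+1+n≰m (u + 2) (≤-trans (≤-reflexive (+-assoc u 2 1)) (≤-trans small lo))
dichotomy-excluded q u lo hi (inj₂ large) = m+1+n≰m (u + 9) (≤-trans (≤-reflexive (+-assoc u 9 1)) (≤-trans hi large))

+-≤-double : ∀ {a b i j s} → a + i ≤ s → b + j ≤ s → a + b + (i + j) ≤ 2 * s
+-≤-double {a} {b} {i} {j} {s} a+i≤s b+j≤s = begin
  a + b + (i + j)   ≡⟨ interchange a b i j ⟩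
  (a + i) + (b + j) ≤⟨ +-mono-≤ a+i≤s b+j≤s ⟩
  s + s             ≡⟨ cong (s +_) (+-identityʳ s) ⟨
  2 * s             ∎
  where open ≤-Reasoning

module Incidences {q : ℕ} (F : FiniteField q) where

  open Coordinates F
  open FiniteField F using (0#; 1#)

  ⟪_∣_⟫ : Triple F → Triple F → ℕ
  ⟪ ℓ ∣ p ⟫ = 𝟙 (incident? F ℓ p)

  ⟪⟫-sym : ∀ ℓ p → ⟪ ℓ ∣ p ⟫ ≡ ⟪ p ∣ ℓ ⟫
  ⟪⟫-sym ℓ p = 𝟙-cong (incident-sym ℓ p) (incident-sym p ℓ) (incident? F ℓ p) (incident? F p ℓ)

  _≟ᵗ_ : DecidableEquality (Triple F)
  _≟ᵗ_ = ≡-dec Fin._≟_ (≡-dec Fin._≟_ Fin._≟_)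

  ∑-lines-through-two : ∀ {x z} → x ∈ points F → z ∈ points F → x ≢ z →
                        ∑[ ℓ ∈ lines F ] (⟪ ℓ ∣ x ⟫ * ⟪ ℓ ∣ z ⟫) ≡ 1
  ∑-lines-through-two {x} {z} x∈ z∈ x≢z = begin
    ∑[ ℓ ∈ lines F ] (⟪ ℓ ∣ x ⟫ * ⟪ ℓ ∣ z ⟫)        ≡⟨ ∑-cong (lines F) (λ {ℓ} _ → 𝟙-*-𝟙 (incident? F ℓ x) (incident? F ℓ z)) ⟩
    ∑[ ℓ ∈ lines F ] 𝟙 (incident? F ℓ x ×-dec incident? F ℓ z)
      ≡⟨ ∑-𝟙-unique _≟ᵗ_ (λ ℓ → incident? F ℓ x ×-dec incident? F ℓ z) normalised-unique
                    line∈ (through₁ , through₂) (λ ℓ∈ (ℓx , ℓz) → unique ℓ∈ ℓx ℓz) ⟩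
    1                                              ∎
    where
    open Join (join x∈ z∈ x≢z)
    open ≡-Reasoning

  ∑-points-on-two : ∀ {ℓ m} → ℓ ∈ lines F → m ∈ lines F → ℓ ≢ m →
                    ∑[ p ∈ points F ] (⟪ ℓ ∣ p ⟫ * ⟪ m ∣ p ⟫) ≡ 1
  ∑-points-on-two {ℓ} {m} ℓ∈ m∈ ℓ≢m =
    trans (∑-cong (points F) (λ {p} _ → cong₂ _*_ (⟪⟫-sym ℓ p) (⟪⟫-sym m p))) (∑-lines-through-two ℓ∈ m∈ ℓ≢m)

  ∑-normalised : ∀ (f : Triple F → ℕ) → ∑ (normalised F) f ≡
    ∑[ y ∈ allFin q ] ∑[ z ∈ allFin q ] f (1# , y , z) + (∑[ z ∈ allFin q ] f (0# , 1# , z) + (f (0# , 0# , 1#) + 0))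
  ∑-normalised f =
    trans (∑-++ (map _ (cartesianProduct (allFin q) (allFin q))) _ f)
          (cong₂ _+_ (trans (∑-map _ (cartesianProduct (allFin q) (allFin q)) f) (∑-cartesianProduct (allFin q) (allFin q) _))
                     (trans (∑-++ (map (λ z → 0# , 1# , z) (allFin q)) _ f) (cong (_+ (f (0# , 0# , 1#) + 0)) (∑-map _ (allFin q) f))))

  ∑-allFin-const : ∀ c → ∑[ _ ∈ allFin q ] c ≡ q * c
  ∑-allFin-const c = trans (∑-const (allFin q) c) (cong (_* c) (length-tabulate {n = q} (λ i → i)))

  ∑-points-1 : ∑[ _ ∈ points F ] 1 ≡ q * q + q + 1
  ∑-points-1 = begin
    ∑[ _ ∈ points F ] 1
      ≡⟨ ∑-normalised (λ _ → 1) ⟩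
    ∑[ _ ∈ allFin q ] ∑[ _ ∈ allFin q ] 1 + (∑[ _ ∈ allFin q ] 1 + (1 + 0))
      ≡⟨ cong₂ _+_ (trans (∑-cong (allFin q) (λ _ → q-ones)) (∑-allFin-const q)) (cong (_+ 1) q-ones) ⟩
    q * q + (q + 1)
      ≡⟨ +-assoc (q * q) q 1 ⟨
    q * q + q + 1 ∎
    where
    open ≡-Reasoning
    q-ones : ∑[ _ ∈ allFin q ] 1 ≡ q
    q-ones = trans (∑-allFin-const 1) (*-identityʳ q)

  ∑-lines-through-[1,0,0] : ∑[ ℓ ∈ lines F ] ⟪ ℓ ∣ (1# , 0# , 0#) ⟫ ≡ suc q
  ∑-lines-through-[1,0,0] = begin
    ∑[ ℓ ∈ lines F ] ⟪ ℓ ∣ e ⟫   ≡⟨ ∑-normalised (λ ℓ → ⟪ ℓ ∣ e ⟫) ⟩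
    ∑[ y ∈ allFin q ] ∑[ z ∈ allFin q ] ⟪ (1# , y , z) ∣ e ⟫ + (∑[ z ∈ allFin q ] ⟪ (0# , 1# , z) ∣ e ⟫ + (⟪ (0# , 0# , 1#) ∣ e ⟫ + 0))
      ≡⟨ cong₂ _+_ (trans (∑-cong (allFin q) (λ {y} _ → trans (∑-cong (allFin q) (λ {z} _ → 𝟙-no (incident? F _ e) ([1,y,z]∤[1,0,0] y z)))
                                                                (∑-zero (allFin q))))
                          (∑-zero (allFin q)))
                   (cong₂ _+_ (trans (∑-cong (allFin q) (λ {z} _ → 𝟙-yes (incident? F _ e) ([0,1,z]∣[1,0,0] z))) (∑-allFin-const 1))
                              (cong (_+ 0) (𝟙-yes (incident? F _ e) [0,0,1]∣[1,0,0]))) ⟩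
    0 + (q * 1 + (1 + 0))        ≡⟨ cong (λ n → n + 1) (*-identityʳ q) ⟩
    q + 1                        ≡⟨ +-comm q 1 ⟩
    suc q                        ∎
    where
    e : Triple F
    e = (1# , 0# , 0#)
    open ≡-Reasoning

  -- As p ∉ ℓ, each point of ℓ is joined to p by exactly one line, and each line through p meets
  -- ℓ in exactly one point.
  points-on≡lines-through : ∀ {ℓ p} → ℓ ∈ lines F → p ∈ points F → ¬ Incident F ℓ p →
                            ∑[ x ∈ points F ] ⟪ ℓ ∣ x ⟫ ≡ ∑[ m ∈ lines F ] ⟪ m ∣ p ⟫
  points-on≡lines-through {ℓ} {p} ℓ∈ p∈ ℓ∤p = begin
    ∑[ x ∈ N ] ⟪ ℓ ∣ x ⟫                                           ≡⟨ ∑-cong N one-line-to-p ⟨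
    ∑[ x ∈ N ] (⟪ ℓ ∣ x ⟫ * ∑[ m ∈ N ] (⟪ m ∣ p ⟫ * ⟪ m ∣ x ⟫))     ≡⟨ ∑-cong N (λ {x} _ → ∑-*ˡ N ⟪ ℓ ∣ x ⟫ _) ⟨
    ∑[ x ∈ N ] ∑[ m ∈ N ] (⟪ ℓ ∣ x ⟫ * (⟪ m ∣ p ⟫ * ⟪ m ∣ x ⟫))   ≡⟨ ∑-swap N N _ ⟩
    ∑[ m ∈ N ] ∑[ x ∈ N ] (⟪ ℓ ∣ x ⟫ * (⟪ m ∣ p ⟫ * ⟪ m ∣ x ⟫))   ≡⟨ ∑-cong N (λ {m} _ → ∑-cong N (λ {x} _ →
                                                                        x∙yz≈y∙xz ⟪ ℓ ∣ x ⟫ ⟪ m ∣ p ⟫ ⟪ m ∣ x ⟫)) ⟩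
    ∑[ m ∈ N ] ∑[ x ∈ N ] (⟪ m ∣ p ⟫ * (⟪ ℓ ∣ x ⟫ * ⟪ m ∣ x ⟫))   ≡⟨ ∑-cong N (λ {m} _ → ∑-*ˡ N ⟪ m ∣ p ⟫ _) ⟩
    ∑[ m ∈ N ] (⟪ m ∣ p ⟫ * ∑[ x ∈ N ] (⟪ ℓ ∣ x ⟫ * ⟪ m ∣ x ⟫))     ≡⟨ ∑-cong N one-point-on-ℓ ⟩
    ∑[ m ∈ N ] ⟪ m ∣ p ⟫                                           ∎
    where
    N : List (Triple F)
    N = normalised F
    open ≡-Reasoning
    one-line-to-p : ∀ {x} → x ∈ N → ⟪ ℓ ∣ x ⟫ * ∑[ m ∈ N ] (⟪ m ∣ p ⟫ * ⟪ m ∣ x ⟫) ≡ ⟪ ℓ ∣ x ⟫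
    one-line-to-p {x} x∈ = 𝟙-*-if (incident? F ℓ x) λ ℓ∣x → ∑-lines-through-two p∈ x∈ λ { refl → ℓ∤p ℓ∣x }
    one-point-on-ℓ : ∀ {m} → m ∈ N → ⟪ m ∣ p ⟫ * ∑[ x ∈ N ] (⟪ ℓ ∣ x ⟫ * ⟪ m ∣ x ⟫) ≡ ⟪ m ∣ p ⟫
    one-point-on-ℓ {m} m∈ = 𝟙-*-if (incident? F m p) λ m∣p → ∑-points-on-two ℓ∈ m∈ λ { refl → ℓ∤p m∣p }

  -- Counting points on ℓ is counting lines through ℓ read as a point, so the direct count for
  -- (1,0,0) propagates: every affine point misses [1,0,0], and (0,1,z), (0,0,1) miss the affine
  -- lines [1,1,0], [1,0,1].
  ∑-lines-through : ∀ {p} → p ∈ points F → ∑[ ℓ ∈ lines F ] ⟪ ℓ ∣ p ⟫ ≡ suc q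
  ∑-lines-through p∈ = go (∈⇒IsNormalised p∈)
    where
    via : ∀ {ℓ p} → IsNormalised ℓ → IsNormalised p → ¬ Incident F ℓ p →
          ∑[ m ∈ lines F ] ⟪ m ∣ ℓ ⟫ ≡ suc q → ∑[ m ∈ lines F ] ⟪ m ∣ p ⟫ ≡ suc q
    via {ℓ} {p} nℓ np ℓ∤p deg-ℓ = begin
      ∑[ m ∈ lines F ] ⟪ m ∣ p ⟫    ≡⟨ points-on≡lines-through (IsNormalised⇒∈ nℓ) (IsNormalised⇒∈ np) ℓ∤p ⟨
      ∑[ x ∈ points F ] ⟪ ℓ ∣ x ⟫   ≡⟨ ∑-cong (points F) (λ {x} _ → ⟪⟫-sym ℓ x) ⟩
      ∑[ x ∈ points F ] ⟪ x ∣ ℓ ⟫   ≡⟨ deg-ℓ ⟩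
      suc q                         ∎
      where open ≡-Reasoning
    affine : ∀ y z → ∑[ m ∈ lines F ] ⟪ m ∣ (1# , y , z) ⟫ ≡ suc q
    affine y z = via [1, 0# , 0# ] [1, y , z ] (λ e → [1,y,z]∤[1,0,0] y z (incident-sym _ _ e)) ∑-lines-through-[1,0,0]
    go : ∀ {p} → IsNormalised p → ∑[ ℓ ∈ lines F ] ⟪ ℓ ∣ p ⟫ ≡ suc q
    go [1, y , z ] = affine y z
    go [0,1, z ]   = via [1, 1# , 0# ] [0,1, z ] (λ e → [0,1,z]∤[1,1,0] z (incident-sym _ _ e)) (affine 1# 0#)
    go [0,0,1]     = via [1, 0# , 1# ] [0,0,1] (λ e → [0,0,1]∤[1,0,1] (incident-sym _ _ e)) (affine 0# 1#)

  ∑-points-on : ∀ {ℓ} → ℓ ∈ lines F → ∑[ p ∈ points F ] ⟪ ℓ ∣ p ⟫ ≡ suc q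
  ∑-points-on {ℓ} ℓ∈ = trans (∑-cong (points F) (λ {p} _ → ⟪⟫-sym ℓ p)) (∑-lines-through ℓ∈)

  ∑-lines-through-pair : ∀ {p p′} → p ∈ points F → p′ ∈ points F →
                         ∑[ ℓ ∈ lines F ] (⟪ ℓ ∣ p ⟫ * ⟪ ℓ ∣ p′ ⟫) ≡ 1 + 𝟙 (p′ ≟ᵗ p) * q
  ∑-lines-through-pair {p} {p′} p∈ p′∈ with p′ ≟ᵗ p
  ... | yes refl = trans (∑-cong (lines F) (λ {ℓ} _ → 𝟙-idem (incident? F ℓ p)))
                         (trans (∑-lines-through p∈) (cong suc (sym (+-identityʳ q))))
  ... | no p′≢p  = ∑-lines-through-two p∈ p′∈ (λ p≡p′ → p′≢p (sym p≡p′))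

module PointSet {q : ℕ} (F : FiniteField q) (S : List (Triple F))
                (S⊆points : All (_∈ points F) S) (S-unique : Unique S) where

  open Coordinates F
  open Incidences F

  private
    ¬1≤0 : ¬ 1 ≤ 0
    ¬1≤0 ()

  ∣_∩S∣ : Triple F → ℕ
  ∣ ℓ ∩S∣ = ∑[ p ∈ S ] ⟪ ℓ ∣ p ⟫

  external? : ∀ ℓ → Dec (∣ ℓ ∩S∣ ≡ 0)
  external? ℓ = ∣ ℓ ∩S∣ ≟ 0

  incident⇒1≤∣∩S∣ : ∀ {ℓ p} → p ∈ S → Incident F ℓ p → 1 ≤ ∣ ℓ ∩S∣
  incident⇒1≤∣∩S∣ {ℓ} {p} p∈ ℓ∣p = ≤-trans (≤-reflexive (sym (𝟙-yes (incident? F ℓ p) ℓ∣p))) (∈⇒≤∑ (λ p → ⟪ ℓ ∣ p ⟫) p∈)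

  u₀≡∑external : u₀ F S ≡ ∑[ ℓ ∈ lines F ] 𝟙 (external? ℓ)
  u₀≡∑external = trans (length-filter (λ ℓ → all? (λ p → ¬? (incident? F ℓ p)) S) (lines F))
                       (∑-cong (lines F) (λ {ℓ} _ → 𝟙-cong (misses⇒external ℓ) (external⇒misses ℓ) _ (external? ℓ)))
    where
    misses⇒external : ∀ ℓ → All (λ p → ¬ Incident F ℓ p) S → ∣ ℓ ∩S∣ ≡ 0
    misses⇒external ℓ misses = trans (∑-cong S (λ {p} p∈ → 𝟙-no (incident? F ℓ p) (All.lookup misses p∈))) (∑-zero S)
    external⇒misses : ∀ ℓ → ∣ ℓ ∩S∣ ≡ 0 → All (λ p → ¬ Incident F ℓ p) S
    external⇒misses ℓ ∣ℓ∩S∣≡0 = All.tabulate λ p∈ ℓ∣p → ¬1≤0 (subst (1 ≤_) ∣ℓ∩S∣≡0 (incident⇒1≤∣∩S∣ p∈ ℓ∣p))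

  ∑-∣∩S∣ : ∑[ ℓ ∈ lines F ] ∣ ℓ ∩S∣ ≡ length S * suc q
  ∑-∣∩S∣ = begin
    ∑[ ℓ ∈ lines F ] ∑[ p ∈ S ] ⟪ ℓ ∣ p ⟫   ≡⟨ ∑-swap (lines F) S _ ⟩
    ∑[ p ∈ S ] ∑[ ℓ ∈ lines F ] ⟪ ℓ ∣ p ⟫   ≡⟨ ∑-cong S (λ p∈ → ∑-lines-through (All.lookup S⊆points p∈)) ⟩
    ∑[ _ ∈ S ] suc q                       ≡⟨ ∑-const S (suc q) ⟩
    length S * suc q                       ∎
    where open ≡-Reasoning

  ∑-∣∩S∣² : ∑[ ℓ ∈ lines F ] (∣ ℓ ∩S∣ * ∣ ℓ ∩S∣) ≡ length S * (length S + q)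
  ∑-∣∩S∣² = begin
    ∑[ ℓ ∈ lines F ] (∣ ℓ ∩S∣ * ∣ ℓ ∩S∣)
      ≡⟨ ∑-cong (lines F) (λ {ℓ} _ → square ℓ) ⟩
    ∑[ ℓ ∈ lines F ] ∑[ p ∈ S ] ∑[ p′ ∈ S ] (⟪ ℓ ∣ p ⟫ * ⟪ ℓ ∣ p′ ⟫)
      ≡⟨ ∑-swap (lines F) S _ ⟩
    ∑[ p ∈ S ] ∑[ ℓ ∈ lines F ] ∑[ p′ ∈ S ] (⟪ ℓ ∣ p ⟫ * ⟪ ℓ ∣ p′ ⟫)
      ≡⟨ ∑-cong S (λ {p} _ → ∑-swap (lines F) S (λ ℓ p′ → ⟪ ℓ ∣ p ⟫ * ⟪ ℓ ∣ p′ ⟫)) ⟩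
    ∑[ p ∈ S ] ∑[ p′ ∈ S ] ∑[ ℓ ∈ lines F ] (⟪ ℓ ∣ p ⟫ * ⟪ ℓ ∣ p′ ⟫)
      ≡⟨ ∑-cong S (λ p∈ → ∑-cong S (λ p′∈ → ∑-lines-through-pair (All.lookup S⊆points p∈) (All.lookup S⊆points p′∈))) ⟩
    ∑[ p ∈ S ] ∑[ p′ ∈ S ] (1 + 𝟙 (p′ ≟ᵗ p) * q)
      ≡⟨ ∑-cong S row ⟩
    ∑[ _ ∈ S ] (length S + q)
      ≡⟨ ∑-const S (length S + q) ⟩
    length S * (length S + q) ∎
    where
    open ≡-Reasoning
    square : ∀ ℓ → ∣ ℓ ∩S∣ * ∣ ℓ ∩S∣ ≡ ∑[ p ∈ S ] ∑[ p′ ∈ S ] (⟪ ℓ ∣ p ⟫ * ⟪ ℓ ∣ p′ ⟫)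
    square ℓ = trans (sym (∑-*ʳ S ∣ ℓ ∩S∣ (λ p → ⟪ ℓ ∣ p ⟫))) (∑-cong S (λ {p} _ → sym (∑-*ˡ S ⟪ ℓ ∣ p ⟫ (λ p′ → ⟪ ℓ ∣ p′ ⟫))))
    row : ∀ {p} → p ∈ S → ∑[ p′ ∈ S ] (1 + 𝟙 (p′ ≟ᵗ p) * q) ≡ length S + q
    row {p} p∈ = begin
      ∑[ p′ ∈ S ] (1 + 𝟙 (p′ ≟ᵗ p) * q)
        ≡⟨ ∑-+ S (λ _ → 1) (λ p′ → 𝟙 (p′ ≟ᵗ p) * q) ⟩
      ∑[ _ ∈ S ] 1 + ∑[ p′ ∈ S ] (𝟙 (p′ ≟ᵗ p) * q)
        ≡⟨ cong₂ _+_ (trans (∑-const S 1) (*-identityʳ (length S))) (∑-δ _≟ᵗ_ S-unique p∈ (λ _ → q)) ⟩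
      length S + q ∎

  -- (k − 1)(k − 3) ≤ 0 for 1 ≤ k ≤ 3.
  3+k²≤4k+3[k≡0] : ∀ k → k ≤ 3 → 3 + k * k ≤ 4 * k + 3 * 𝟙 (k ≟ 0)
  3+k²≤4k+3[k≡0] 0 _ = ≤-refl
  3+k²≤4k+3[k≡0] 1 _ = ≤-refl
  3+k²≤4k+3[k≡0] 2 _ = n≤1+n 7
  3+k²≤4k+3[k≡0] 3 _ = ≤-refl
  3+k²≤4k+3[k≡0] (suc (suc (suc (suc _)))) (s≤s (s≤s (s≤s ())))

  all-∣∩S∣≤3⇒ : All (λ ℓ → ∣ ℓ ∩S∣ ≤ 3) (lines F) →
                3 * ∑[ _ ∈ lines F ] 1 + ∑[ ℓ ∈ lines F ] (∣ ℓ ∩S∣ * ∣ ℓ ∩S∣)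
                  ≤ 4 * ∑[ ℓ ∈ lines F ] ∣ ℓ ∩S∣ + 3 * ∑[ ℓ ∈ lines F ] 𝟙 (external? ℓ)
  all-∣∩S∣≤3⇒ ≤3 = begin
    3 * ∑[ _ ∈ ℒ ] 1 + ∑[ ℓ ∈ ℒ ] (∣ ℓ ∩S∣ * ∣ ℓ ∩S∣)      ≡⟨ cong (_+ ∑[ ℓ ∈ ℒ ] (∣ ℓ ∩S∣ * ∣ ℓ ∩S∣)) (∑-*ˡ ℒ 3 (λ _ → 1)) ⟨
    ∑[ _ ∈ ℒ ] (3 * 1) + ∑[ ℓ ∈ ℒ ] (∣ ℓ ∩S∣ * ∣ ℓ ∩S∣)    ≡⟨ ∑-+ ℒ (λ _ → 3) (λ ℓ → ∣ ℓ ∩S∣ * ∣ ℓ ∩S∣) ⟨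
    ∑[ ℓ ∈ ℒ ] (3 + ∣ ℓ ∩S∣ * ∣ ℓ ∩S∣)                     ≤⟨ ∑-mono-≤ ℒ (λ {ℓ} ℓ∈ → 3+k²≤4k+3[k≡0] ∣ ℓ ∩S∣ (All.lookup ≤3 ℓ∈)) ⟩
    ∑[ ℓ ∈ ℒ ] (4 * ∣ ℓ ∩S∣ + 3 * 𝟙 (external? ℓ))          ≡⟨ ∑-+ ℒ (λ ℓ → 4 * ∣ ℓ ∩S∣) (λ ℓ → 3 * 𝟙 (external? ℓ)) ⟩
    ∑[ ℓ ∈ ℒ ] (4 * ∣ ℓ ∩S∣) + ∑[ ℓ ∈ ℒ ] (3 * 𝟙 (external? ℓ)) ≡⟨ cong₂ _+_ (∑-*ˡ ℒ 4 ∣_∩S∣) (∑-*ˡ ℒ 3 (λ ℓ → 𝟙 (external? ℓ))) ⟩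
    4 * ∑[ ℓ ∈ ℒ ] ∣ ℓ ∩S∣ + 3 * ∑[ ℓ ∈ ℒ ] 𝟙 (external? ℓ) ∎
    where
    ℒ : List (Triple F)
    ℒ = lines F
    open ≤-Reasoning

  1≤𝟙[k≡0]+k : ∀ k → 1 ≤ 𝟙 (k ≟ 0) + k
  1≤𝟙[k≡0]+k zero    = s≤s z≤n
  1≤𝟙[k≡0]+k (suc k) = s≤s z≤n

  external⇒∉S : ∀ {ℓ R} → ∣ ℓ ∩S∣ ≡ 0 → Incident F ℓ R → R ∉ S
  external⇒∉S ∣ℓ∩S∣≡0 ℓ∣R R∈S = ¬1≤0 (subst (1 ≤_) ∣ℓ∩S∣≡0 (incident⇒1≤∣∩S∣ R∈S ℓ∣R))

  external-through : Triple F → ℕ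
  external-through R = ∑[ ℓ ∈ lines F ] (⟪ ℓ ∣ R ⟫ * 𝟙 (external? ℓ))

  secant-through : Triple F → ℕ
  secant-through R = ∑[ ℓ ∈ lines F ] (⟪ ℓ ∣ R ⟫ * 𝟙 (¬? (external? ℓ)))

  external+secant-through : ∀ {R} → R ∈ points F → external-through R + secant-through R ≡ suc q
  external+secant-through {R} R∈ = begin
    external-through R + secant-through R                        ≡⟨ ∑-+ (lines F) _ _ ⟨
    ∑[ ℓ ∈ lines F ] (⟪ ℓ ∣ R ⟫ * 𝟙 (external? ℓ) + ⟪ ℓ ∣ R ⟫ * 𝟙 (¬? (external? ℓ)))
      ≡⟨ ∑-cong (lines F) (λ {ℓ} _ → trans (sym (*-distribˡ-+ ⟪ ℓ ∣ R ⟫ _ _))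
                                           (trans (cong (⟪ ℓ ∣ R ⟫ *_) (𝟙-+-𝟙¬ (external? ℓ))) (*-identityʳ _))) ⟩
    ∑[ ℓ ∈ lines F ] ⟪ ℓ ∣ R ⟫                                   ≡⟨ ∑-lines-through R∈ ⟩
    suc q                                                        ∎
    where open ≡-Reasoning

  external-through+length≤q+1 : ∀ {R Ls} → R ∈ points F → Unique Ls → All (_∈ lines F) Ls →
                     All (λ ℓ → Incident F ℓ R × 1 ≤ ∣ ℓ ∩S∣) Ls → external-through R + length Ls ≤ suc q
  external-through+length≤q+1 {R} {Ls} R∈ Ls-unique Ls⊆ secants = begin
    external-through R + length Ls           ≤⟨ +-monoʳ-≤ (external-through R)
                                                  (length≤∑ _≟ᵗ_ normalised-unique Ls-unique Ls⊆ _ (All.map secant-counted secants)) ⟩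
    external-through R + secant-through R    ≡⟨ external+secant-through R∈ ⟩
    suc q                                    ∎
    where
    open ≤-Reasoning
    secant-counted : ∀ {ℓ} → Incident F ℓ R × 1 ≤ ∣ ℓ ∩S∣ → 1 ≤ ⟪ ℓ ∣ R ⟫ * 𝟙 (¬? (external? ℓ))
    secant-counted {ℓ} (ℓ∣R , 1≤∣ℓ∩S∣) = ≤-reflexive (sym (cong₂ _*_ (𝟙-yes (incident? F ℓ R) ℓ∣R)
                                                       (𝟙-yes (¬? (external? ℓ)) (λ ≡0 → ¬1≤0 (subst (1 ≤_) ≡0 1≤∣ℓ∩S∣)))))

  ∑-through-∉S : ∀ {R} → R ∈ points F → R ∉ S → ∑[ ℓ ∈ lines F ] (⟪ ℓ ∣ R ⟫ * ∣ ℓ ∩S∣) ≡ length S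
  ∑-through-∉S {R} R∈ R∉S = begin
    ∑[ ℓ ∈ lines F ] (⟪ ℓ ∣ R ⟫ * ∑[ p ∈ S ] ⟪ ℓ ∣ p ⟫)     ≡⟨ ∑-cong (lines F) (λ {ℓ} _ → ∑-*ˡ S ⟪ ℓ ∣ R ⟫ _) ⟨
    ∑[ ℓ ∈ lines F ] ∑[ p ∈ S ] (⟪ ℓ ∣ R ⟫ * ⟪ ℓ ∣ p ⟫)   ≡⟨ ∑-swap (lines F) S _ ⟩
    ∑[ p ∈ S ] ∑[ ℓ ∈ lines F ] (⟪ ℓ ∣ R ⟫ * ⟪ ℓ ∣ p ⟫)   ≡⟨ ∑-cong S (λ p∈ → ∑-lines-through-two R∈ (All.lookup S⊆points p∈)
                                                                                          (λ { refl → R∉S p∈ })) ⟩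
    ∑[ _ ∈ S ] 1                                         ≡⟨ trans (∑-const S 1) (*-identityʳ (length S)) ⟩
    length S                                             ∎
    where open ≡-Reasoning

  module LongSecant (∣S∣≡q+1 : length S ≡ suc q) {ℓ₀ : Triple F} (ℓ₀∈ : ℓ₀ ∈ lines F) where

    open import Data.List.Membership.DecPropositional _≟ᵗ_ using (_∈?_)

    ℓ₀∖S : List (Triple F)
    ℓ₀∖S = filter (λ R → incident? F ℓ₀ R ×-dec ¬? (R ∈? S)) (points F)

    S∖ℓ₀ : List (Triple F)
    S∖ℓ₀ = filter (λ p → ¬? (incident? F ℓ₀ p)) S

    ∈ℓ₀∖S⇒ : ∀ {R} → R ∈ ℓ₀∖S → R ∈ points F × Incident F ℓ₀ R × R ∉ S
    ∈ℓ₀∖S⇒ = ∈-filter⁻ (λ R → incident? F ℓ₀ R ×-dec ¬? (R ∈? S))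

    ∈S∖ℓ₀⇒ : ∀ {p} → p ∈ S∖ℓ₀ → p ∈ S × ¬ Incident F ℓ₀ p
    ∈S∖ℓ₀⇒ = ∈-filter⁻ (λ p → ¬? (incident? F ℓ₀ p))

    length-S∖ℓ₀ : length S∖ℓ₀ + ∣ ℓ₀ ∩S∣ ≡ suc q
    length-S∖ℓ₀ = begin
      length S∖ℓ₀ + ∣ ℓ₀ ∩S∣                                 ≡⟨ cong (_+ ∣ ℓ₀ ∩S∣) (length-filter _ S) ⟩
      ∑[ p ∈ S ] 𝟙 (off-ℓ₀? p) + ∑[ p ∈ S ] ⟪ ℓ₀ ∣ p ⟫        ≡⟨ ∑-+ S _ _ ⟨
      ∑[ p ∈ S ] (𝟙 (off-ℓ₀? p) + ⟪ ℓ₀ ∣ p ⟫)                ≡⟨ ∑-cong S (λ {p} _ → trans (+-comm (𝟙 (off-ℓ₀? p)) ⟪ ℓ₀ ∣ p ⟫)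
                                                                                           (𝟙-+-𝟙¬ (incident? F ℓ₀ p))) ⟩
      ∑[ _ ∈ S ] 1                                           ≡⟨ trans (∑-const S 1) (*-identityʳ (length S)) ⟩
      length S                                               ≡⟨ ∣S∣≡q+1 ⟩
      suc q                                                  ∎
      where
      open ≡-Reasoning
      off-ℓ₀? : ∀ p → Dec (¬ Incident F ℓ₀ p)
      off-ℓ₀? p = ¬? (incident? F ℓ₀ p)

    length-ℓ₀∖S : length ℓ₀∖S + ∣ ℓ₀ ∩S∣ ≡ suc q
    length-ℓ₀∖S = begin
      length ℓ₀∖S + ∣ ℓ₀ ∩S∣
        ≡⟨ cong₂ _+_ (length-filter _ (points F)) (sym (∑-restrict _≟ᵗ_ normalised-unique S-unique S⊆points (λ R → ⟪ ℓ₀ ∣ R ⟫))) ⟩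
      ∑[ R ∈ 𝒫 ] 𝟙 (incident? F ℓ₀ R ×-dec ¬? (R ∈? S)) + ∑[ R ∈ 𝒫 ] (𝟙 (R ∈? S) * ⟪ ℓ₀ ∣ R ⟫)
        ≡⟨ ∑-+ 𝒫 _ _ ⟨
      ∑[ R ∈ 𝒫 ] (𝟙 (incident? F ℓ₀ R ×-dec ¬? (R ∈? S)) + 𝟙 (R ∈? S) * ⟪ ℓ₀ ∣ R ⟫)
        ≡⟨ ∑-cong 𝒫 (λ {R} _ → on-ℓ₀ R) ⟩
      ∑[ R ∈ 𝒫 ] ⟪ ℓ₀ ∣ R ⟫
        ≡⟨ ∑-points-on ℓ₀∈ ⟩
      suc q ∎
      where
      open ≡-Reasoning
      𝒫 : List (Triple F)
      𝒫 = points F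
      on-ℓ₀ : ∀ R → 𝟙 (incident? F ℓ₀ R ×-dec ¬? (R ∈? S)) + 𝟙 (R ∈? S) * ⟪ ℓ₀ ∣ R ⟫ ≡ ⟪ ℓ₀ ∣ R ⟫
      on-ℓ₀ R = begin
        𝟙 (incident? F ℓ₀ R ×-dec ¬? (R ∈? S)) + 𝟙 (R ∈? S) * ⟪ ℓ₀ ∣ R ⟫
          ≡⟨ cong₂ _+_ (trans (sym (𝟙-*-𝟙 (incident? F ℓ₀ R) _)) (*-comm ⟪ ℓ₀ ∣ R ⟫ _)) refl ⟩
        𝟙 (¬? (R ∈? S)) * ⟪ ℓ₀ ∣ R ⟫ + 𝟙 (R ∈? S) * ⟪ ℓ₀ ∣ R ⟫
          ≡⟨ *-distribʳ-+ ⟪ ℓ₀ ∣ R ⟫ (𝟙 (¬? (R ∈? S))) _ ⟨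
        (𝟙 (¬? (R ∈? S)) + 𝟙 (R ∈? S)) * ⟪ ℓ₀ ∣ R ⟫
          ≡⟨ cong (_* ⟪ ℓ₀ ∣ R ⟫) (trans (+-comm (𝟙 (¬? (R ∈? S))) (𝟙 (R ∈? S))) (𝟙-+-𝟙¬ (R ∈? S))) ⟩
        1 * ⟪ ℓ₀ ∣ R ⟫
          ≡⟨ +-identityʳ _ ⟩
        ⟪ ℓ₀ ∣ R ⟫ ∎

    -- Each external line meets ℓ₀ in exactly one point, necessarily outside S.
    u₀≡∑ℓ₀∖S : 1 ≤ ∣ ℓ₀ ∩S∣ → ∑[ ℓ ∈ lines F ] 𝟙 (external? ℓ) ≡ ∑ ℓ₀∖S external-through
    u₀≡∑ℓ₀∖S 1≤n = sym (begin
      ∑ ℓ₀∖S external-through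
        ≡⟨ ∑-filter on-ℓ₀∖S? (points F) external-through ⟩
      ∑[ R ∈ 𝒫 ] (𝟙 (on-ℓ₀∖S? R) * ∑[ ℓ ∈ ℒ ] (⟪ ℓ ∣ R ⟫ * 𝟙 (external? ℓ)))
        ≡⟨ ∑-cong 𝒫 (λ {R} _ → ∑-*ˡ ℒ (𝟙 (on-ℓ₀∖S? R)) _) ⟨
      ∑[ R ∈ 𝒫 ] ∑[ ℓ ∈ ℒ ] (𝟙 (on-ℓ₀∖S? R) * (⟪ ℓ ∣ R ⟫ * 𝟙 (external? ℓ)))
        ≡⟨ ∑-swap 𝒫 ℒ _ ⟩
      ∑[ ℓ ∈ ℒ ] ∑[ R ∈ 𝒫 ] (𝟙 (on-ℓ₀∖S? R) * (⟪ ℓ ∣ R ⟫ * 𝟙 (external? ℓ)))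
        ≡⟨ ∑-cong ℒ (λ {ℓ} _ → ∑-cong 𝒫 (λ {R} _ → x∙yz≈z∙xy (𝟙 (on-ℓ₀∖S? R)) ⟪ ℓ ∣ R ⟫ (𝟙 (external? ℓ)))) ⟩
      ∑[ ℓ ∈ ℒ ] ∑[ R ∈ 𝒫 ] (𝟙 (external? ℓ) * (𝟙 (on-ℓ₀∖S? R) * ⟪ ℓ ∣ R ⟫))
        ≡⟨ ∑-cong ℒ (λ {ℓ} _ → ∑-*ˡ 𝒫 (𝟙 (external? ℓ)) _) ⟩
      ∑[ ℓ ∈ ℒ ] (𝟙 (external? ℓ) * ∑[ R ∈ 𝒫 ] (𝟙 (on-ℓ₀∖S? R) * ⟪ ℓ ∣ R ⟫))
        ≡⟨ ∑-cong ℒ (λ {ℓ} ℓ∈ → 𝟙-*-if (external? ℓ) (meets-ℓ₀∖S-once ℓ∈)) ⟩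
      ∑[ ℓ ∈ ℒ ] 𝟙 (external? ℓ) ∎)
      where
      open ≡-Reasoning
      𝒫 : List (Triple F)
      𝒫 = points F
      ℒ : List (Triple F)
      ℒ = lines F
      on-ℓ₀∖S? : ∀ R → Dec (Incident F ℓ₀ R × R ∉ S)
      on-ℓ₀∖S? R = incident? F ℓ₀ R ×-dec ¬? (R ∈? S)
      meets-ℓ₀∖S-once : ∀ {ℓ} → ℓ ∈ ℒ → ∣ ℓ ∩S∣ ≡ 0 → ∑[ R ∈ 𝒫 ] (𝟙 (on-ℓ₀∖S? R) * ⟪ ℓ ∣ R ⟫) ≡ 1
      meets-ℓ₀∖S-once {ℓ} ℓ∈ ∣ℓ∩S∣≡0 = begin
        ∑[ R ∈ 𝒫 ] (𝟙 (on-ℓ₀∖S? R) * ⟪ ℓ ∣ R ⟫)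
          ≡⟨ ∑-cong 𝒫 (λ {R} _ → cong (_* ⟪ ℓ ∣ R ⟫) (𝟙-*-𝟙 (incident? F ℓ₀ R) (¬? (R ∈? S)))) ⟨
        ∑[ R ∈ 𝒫 ] (⟪ ℓ₀ ∣ R ⟫ * 𝟙 (¬? (R ∈? S)) * ⟪ ℓ ∣ R ⟫)
          ≡⟨ ∑-cong 𝒫 (λ {R} _ → trans (*-assoc ⟪ ℓ₀ ∣ R ⟫ _ _)
                                       (cong (⟪ ℓ₀ ∣ R ⟫ *_) (𝟙-*-𝟙-⇒ (external⇒∉S ∣ℓ∩S∣≡0) (¬? (R ∈? S)) (incident? F ℓ R)))) ⟩
        ∑[ R ∈ 𝒫 ] (⟪ ℓ₀ ∣ R ⟫ * ⟪ ℓ ∣ R ⟫)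
          ≡⟨ ∑-points-on-two ℓ₀∈ ℓ∈ (λ { refl → ¬1≤0 (subst (1 ≤_) ∣ℓ∩S∣≡0 1≤n) }) ⟩
        1 ∎

    -- The lines through R ∉ S partition S: ℓ₀ takes n of its points, and each of the other q
    -- lines through R is external or takes at least one.
    ∣ℓ₀∩S∣≤external-through+1 : ∀ {R} → R ∈ ℓ₀∖S → ∣ ℓ₀ ∩S∣ ≤ external-through R + 1
    ∣ℓ₀∩S∣≤external-through+1 {R} R∈ℓ₀∖S = +-cancelʳ-≤ q _ _ (begin
      ∣ ℓ₀ ∩S∣ + q                                        ≡⟨ cong (∣ ℓ₀ ∩S∣ +_) others≡q ⟨
      ∣ ℓ₀ ∩S∣ + ∑[ ℓ ∈ ℒ ] (𝟙 (¬? (ℓ ≟ᵗ ℓ₀)) * ⟪ ℓ ∣ R ⟫)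
        ≤⟨ +-mono-≤ (≤-trans (m≤n+m _ (𝟙 (external? ℓ₀))) (≤-reflexive (sym (trans (cong (_* _) ⟪ℓ₀∣R⟫≡1) (+-identityʳ _)))))
                    (∑-mono-≤ ℒ (λ {ℓ} _ → *-monoʳ-≤ (𝟙 (¬? (ℓ ≟ᵗ ℓ₀))) (through-R-counted ℓ))) ⟩
      g ℓ₀ + ∑[ ℓ ∈ ℒ ] (𝟙 (¬? (ℓ ≟ᵗ ℓ₀)) * g ℓ)          ≡⟨ ∑-split _≟ᵗ_ normalised-unique ℓ₀∈ g ⟨
      ∑ ℒ g                                               ≡⟨ ∑-cong ℒ (λ {ℓ} _ → *-distribˡ-+ ⟪ ℓ ∣ R ⟫ _ _) ⟩
      ∑[ ℓ ∈ ℒ ] (⟪ ℓ ∣ R ⟫ * 𝟙 (external? ℓ) + ⟪ ℓ ∣ R ⟫ * ∣ ℓ ∩S∣) ≡⟨ ∑-+ ℒ _ _ ⟩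
      external-through R + ∑[ ℓ ∈ ℒ ] (⟪ ℓ ∣ R ⟫ * ∣ ℓ ∩S∣) ≡⟨ cong (external-through R +_) (trans (∑-through-∉S R∈ R∉S) ∣S∣≡q+1) ⟩
      external-through R + suc q                          ≡⟨ +-assoc (external-through R) 1 q ⟨
      external-through R + 1 + q                          ∎)
      where
      open ≤-Reasoning
      ℒ : List (Triple F)
      ℒ = lines F
      R∈ : R ∈ points F
      R∈ = proj₁ (∈ℓ₀∖S⇒ R∈ℓ₀∖S)
      R∉S : R ∉ S
      R∉S = proj₂ (proj₂ (∈ℓ₀∖S⇒ R∈ℓ₀∖S))
      ⟪ℓ₀∣R⟫≡1 : ⟪ ℓ₀ ∣ R ⟫ ≡ 1
      ⟪ℓ₀∣R⟫≡1 = 𝟙-yes (incident? F ℓ₀ R) (proj₁ (proj₂ (∈ℓ₀∖S⇒ R∈ℓ₀∖S)))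
      g : Triple F → ℕ
      g ℓ = ⟪ ℓ ∣ R ⟫ * (𝟙 (external? ℓ) + ∣ ℓ ∩S∣)
      through-R-counted : ∀ ℓ → ⟪ ℓ ∣ R ⟫ ≤ g ℓ
      through-R-counted ℓ = ≤-trans (≤-reflexive (sym (*-identityʳ _))) (*-monoʳ-≤ ⟪ ℓ ∣ R ⟫ (1≤𝟙[k≡0]+k ∣ ℓ ∩S∣))
      others≡q : ∑[ ℓ ∈ ℒ ] (𝟙 (¬? (ℓ ≟ᵗ ℓ₀)) * ⟪ ℓ ∣ R ⟫) ≡ q
      others≡q = suc-injective (sym (begin-equality
        suc q                                                   ≡⟨ ∑-lines-through R∈ ⟨
        ∑[ ℓ ∈ ℒ ] ⟪ ℓ ∣ R ⟫                                     ≡⟨ ∑-split _≟ᵗ_ normalised-unique ℓ₀∈ (λ ℓ → ⟪ ℓ ∣ R ⟫) ⟩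
        ⟪ ℓ₀ ∣ R ⟫ + ∑[ ℓ ∈ ℒ ] (𝟙 (¬? (ℓ ≟ᵗ ℓ₀)) * ⟪ ℓ ∣ R ⟫)   ≡⟨ cong (_+ ∑[ ℓ ∈ ℒ ] (𝟙 (¬? (ℓ ≟ᵗ ℓ₀)) * ⟪ ℓ ∣ R ⟫)) ⟪ℓ₀∣R⟫≡1 ⟩
        suc (∑[ ℓ ∈ ℒ ] (𝟙 (¬? (ℓ ≟ᵗ ℓ₀)) * ⟪ ℓ ∣ R ⟫))          ∎))

    private
      line-through : ∀ {R Q} → R ∈ ℓ₀∖S → Q ∈ S∖ℓ₀ → Join R Q
      line-through R∈ℓ₀∖S Q∈S∖ℓ₀ =
        join (proj₁ (∈ℓ₀∖S⇒ R∈ℓ₀∖S)) (All.lookup S⊆points (proj₁ (∈S∖ℓ₀⇒ Q∈S∖ℓ₀)))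
             (λ { refl → proj₂ (proj₂ (∈ℓ₀∖S⇒ R∈ℓ₀∖S)) (proj₁ (∈S∖ℓ₀⇒ Q∈S∖ℓ₀)) })

      ℓ₀-secant : ∀ {R} → 1 ≤ ∣ ℓ₀ ∩S∣ → R ∈ ℓ₀∖S → Incident F ℓ₀ R × 1 ≤ ∣ ℓ₀ ∩S∣
      ℓ₀-secant 1≤n R∈ℓ₀∖S = proj₁ (proj₂ (∈ℓ₀∖S⇒ R∈ℓ₀∖S)) , 1≤n

      join-secant : ∀ {R Q} (R∈ : R ∈ ℓ₀∖S) (Q∈ : Q ∈ S∖ℓ₀) →
                    let ℓ = Join.line (line-through R∈ Q∈) in Incident F ℓ R × 1 ≤ ∣ ℓ ∩S∣
      join-secant R∈ Q∈ = through₁ , incident⇒1≤∣∩S∣ (proj₁ (∈S∖ℓ₀⇒ Q∈)) through₂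
        where open Join (line-through R∈ Q∈)

      join≢ℓ₀ : ∀ {R Q} (R∈ : R ∈ ℓ₀∖S) (Q∈ : Q ∈ S∖ℓ₀) → ℓ₀ ≢ Join.line (line-through R∈ Q∈)
      join≢ℓ₀ R∈ Q∈ ℓ₀≡RQ = proj₂ (∈S∖ℓ₀⇒ Q∈) (subst (λ ℓ → Incident F ℓ _) (sym ℓ₀≡RQ) (Join.through₂ (line-through R∈ Q∈)))

    two-secants : ∀ {R Q} → 1 ≤ ∣ ℓ₀ ∩S∣ → R ∈ ℓ₀∖S → Q ∈ S∖ℓ₀ → external-through R + 2 ≤ suc q
    two-secants 1≤n R∈ Q∈ =
      external-through+length≤q+1 (proj₁ (∈ℓ₀∖S⇒ R∈)) ((join≢ℓ₀ R∈ Q∈ ∷ []) ∷ [] ∷ [])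
                       (ℓ₀∈ ∷ Join.line∈ (line-through R∈ Q∈) ∷ [])
                       (ℓ₀-secant 1≤n R∈ ∷ join-secant R∈ Q∈ ∷ [])

    three-secants : ∀ {R Q₁ Q₂} → 1 ≤ ∣ ℓ₀ ∩S∣ → R ∈ ℓ₀∖S → Q₁ ∈ S∖ℓ₀ → Q₂ ∈ S∖ℓ₀ →
                    (∀ {ℓ} → ℓ ∈ lines F → Incident F ℓ Q₁ → Incident F ℓ Q₂ → ¬ Incident F ℓ R) →
                    external-through R + 3 ≤ suc q
    three-secants 1≤n R∈ Q₁∈ Q₂∈ R∉Q₁Q₂ =
      external-through+length≤q+1 (proj₁ (∈ℓ₀∖S⇒ R∈)) ((join≢ℓ₀ R∈ Q₁∈ ∷ join≢ℓ₀ R∈ Q₂∈ ∷ []) ∷ (L₁≢L₂ ∷ []) ∷ [] ∷ [])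
                       (ℓ₀∈ ∷ L₁.line∈ ∷ L₂.line∈ ∷ [])
                       (ℓ₀-secant 1≤n R∈ ∷ join-secant R∈ Q₁∈ ∷ join-secant R∈ Q₂∈ ∷ [])
      where
      module L₁ = Join (line-through R∈ Q₁∈)
      module L₂ = Join (line-through R∈ Q₂∈)
      L₁≢L₂ : L₁.line ≢ L₂.line
      L₁≢L₂ L₁≡L₂ = R∉Q₁Q₂ L₁.line∈ L₁.through₂ (subst (λ ℓ → Incident F ℓ _) (sym L₁≡L₂) L₂.through₂) L₁.through₁

    -- The line Q₁Q₂ ≠ ℓ₀ passes through at most one of R₁, R₂; through the other one pass the
    -- three distinct secants ℓ₀, RQ₁ and RQ₂.
    two-missing : ∀ {R₁ R₂ Q₁ Q₂} → 1 ≤ ∣ ℓ₀ ∩S∣ → R₁ ∈ ℓ₀∖S → R₂ ∈ ℓ₀∖S → R₁ ≢ R₂ →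
                  Q₁ ∈ S∖ℓ₀ → Q₂ ∈ S∖ℓ₀ → Q₁ ≢ Q₂ →
                  external-through R₁ + external-through R₂ + 5 ≤ 2 * suc q
    two-missing {R₁} {R₂} {Q₁} {Q₂} 1≤n R₁∈ R₂∈ R₁≢R₂ Q₁∈ Q₂∈ Q₁≢Q₂ = by-cases (incident? F Q₁Q₂.line R₁)
      where
      module Q₁Q₂ = Join (join (All.lookup S⊆points (proj₁ (∈S∖ℓ₀⇒ Q₁∈)))
                               (All.lookup S⊆points (proj₁ (∈S∖ℓ₀⇒ Q₂∈))) Q₁≢Q₂)
      module R₁R₂ = Join (join (proj₁ (∈ℓ₀∖S⇒ R₁∈)) (proj₁ (∈ℓ₀∖S⇒ R₂∈)) R₁≢R₂)
      e₁ : ℕ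
      e₁ = external-through R₁
      e₂ : ℕ
      e₂ = external-through R₂
      avoids : ∀ {R} → ¬ Incident F Q₁Q₂.line R →
               ∀ {ℓ} → ℓ ∈ lines F → Incident F ℓ Q₁ → Incident F ℓ Q₂ → ¬ Incident F ℓ R
      avoids Q₁Q₂∤R ℓ∈ ℓ∣Q₁ ℓ∣Q₂ ℓ∣R = Q₁Q₂∤R (subst (λ ℓ → Incident F ℓ _) (Q₁Q₂.unique ℓ∈ ℓ∣Q₁ ℓ∣Q₂) ℓ∣R)
      not-both : Incident F Q₁Q₂.line R₁ → ¬ Incident F Q₁Q₂.line R₂
      not-both Q₁Q₂∣R₁ Q₁Q₂∣R₂ = proj₂ (∈S∖ℓ₀⇒ Q₁∈) (subst (λ ℓ → Incident F ℓ Q₁) Q₁Q₂≡ℓ₀ Q₁Q₂.through₁)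
        where
        Q₁Q₂≡ℓ₀ : Q₁Q₂.line ≡ ℓ₀
        Q₁Q₂≡ℓ₀ = trans (R₁R₂.unique Q₁Q₂.line∈ Q₁Q₂∣R₁ Q₁Q₂∣R₂)
                        (sym (R₁R₂.unique ℓ₀∈ (proj₁ (proj₂ (∈ℓ₀∖S⇒ R₁∈))) (proj₁ (proj₂ (∈ℓ₀∖S⇒ R₂∈)))))
      by-cases : Dec (Incident F Q₁Q₂.line R₁) → e₁ + e₂ + 5 ≤ 2 * suc q
      by-cases (no Q₁Q₂∤R₁)  = +-≤-double {e₁} {e₂} {3} {2} (three-secants 1≤n R₁∈ Q₁∈ Q₂∈ (avoids Q₁Q₂∤R₁))
                                                           (two-secants 1≤n R₂∈ Q₁∈)
      by-cases (yes Q₁Q₂∣R₁) = +-≤-double {e₁} {e₂} {2} {3} (two-secants 1≤n R₁∈ Q₁∈)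
                                                           (three-secants 1≤n R₂∈ Q₁∈ Q₂∈ (avoids (not-both Q₁Q₂∣R₁)))

    ∣ℓ₀∖S∣*∣ℓ₀∩S∣≤ : length ℓ₀∖S * ∣ ℓ₀ ∩S∣ ≤ ∑ ℓ₀∖S external-through + length ℓ₀∖S
    ∣ℓ₀∖S∣*∣ℓ₀∩S∣≤ = begin
      length ℓ₀∖S * ∣ ℓ₀ ∩S∣                           ≡⟨ ∑-const ℓ₀∖S ∣ ℓ₀ ∩S∣ ⟨
      ∑[ _ ∈ ℓ₀∖S ] ∣ ℓ₀ ∩S∣                            ≤⟨ ∑-mono-≤ ℓ₀∖S ∣ℓ₀∩S∣≤external-through+1 ⟩
      ∑[ R ∈ ℓ₀∖S ] (external-through R + 1)           ≡⟨ ∑-+ ℓ₀∖S external-through (λ _ → 1) ⟩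
      ∑ ℓ₀∖S external-through + ∑[ _ ∈ ℓ₀∖S ] 1        ≡⟨ cong (∑ ℓ₀∖S external-through +_)
                                                                (trans (∑-const ℓ₀∖S 1) (*-identityʳ _)) ⟩
      ∑ ℓ₀∖S external-through + length ℓ₀∖S            ∎
      where open ≤-Reasoning

    dichotomy : 4 ≤ ∣ ℓ₀ ∩S∣ →
                let u = ∑[ ℓ ∈ lines F ] 𝟙 (external? ℓ) in u + 3 ≤ 2 * q ⊎ 3 * q ≤ u + 9
    dichotomy 4≤n = subst (λ u → u + 3 ≤ 2 * q ⊎ 3 * q ≤ u + 9) (sym (u₀≡∑ℓ₀∖S 1≤n))
                          (by-shape ℓ₀∖S S∖ℓ₀ refl refl (+-cancelʳ-≡ _ _ _ (trans length-ℓ₀∖S (sym length-S∖ℓ₀))))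
      where
      n : ℕ
      n = ∣ ℓ₀ ∩S∣
      1≤n : 1 ≤ n
      1≤n = ≤-trans (s≤s z≤n) 4≤n
      distinct : ∀ {xs : List (Triple F)} {x y} → Unique (x ∷ y ∷ xs) → x ≢ y
      distinct ((x≢y ∷ _) ∷ _) = x≢y
      in-ℓ₀∖S : ∀ {Rs R} → ℓ₀∖S ≡ Rs → R ∈ Rs → R ∈ ℓ₀∖S
      in-ℓ₀∖S ℓ₀∖S≡ = subst (_ ∈_) (sym ℓ₀∖S≡)
      in-S∖ℓ₀ : ∀ {Qs Q} → S∖ℓ₀ ≡ Qs → Q ∈ Qs → Q ∈ S∖ℓ₀
      in-S∖ℓ₀ S∖ℓ₀≡ = subst (_ ∈_) (sym S∖ℓ₀≡)
      missing-count : ∀ {Rs} → ℓ₀∖S ≡ Rs → length Rs + n ≡ suc q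
      missing-count ℓ₀∖S≡ = subst (λ Rs → length Rs + n ≡ suc q) ℓ₀∖S≡ length-ℓ₀∖S
      by-shape : ∀ Rs Qs → ℓ₀∖S ≡ Rs → S∖ℓ₀ ≡ Qs → length Rs ≡ length Qs →
                 let u = ∑ Rs external-through in u + 3 ≤ 2 * q ⊎ 3 * q ≤ u + 9
      by-shape [] _ ℓ₀∖S≡ _ _ = inj₁ (none-missing-arith q n (missing-count ℓ₀∖S≡) 4≤n)
      by-shape (R ∷ []) (Q ∷ []) ℓ₀∖S≡ S∖ℓ₀≡ _ =
        inj₁ (one-missing-arith q n (external-through R + 0) (missing-count ℓ₀∖S≡) 4≤n
                (subst (λ e → e + 2 ≤ suc q) (sym (+-identityʳ _))
                       (two-secants 1≤n (in-ℓ₀∖S ℓ₀∖S≡ (here refl)) (in-S∖ℓ₀ S∖ℓ₀≡ (here refl)))))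
      by-shape (R₁ ∷ R₂ ∷ []) (Q₁ ∷ Q₂ ∷ []) ℓ₀∖S≡ S∖ℓ₀≡ _ =
        inj₁ (two-missing-arith q (external-through R₁ + (external-through R₂ + 0))
                (subst (λ e → e + 5 ≤ 2 * suc q) (cong (external-through R₁ +_) (sym (+-identityʳ (external-through R₂))))
                       (two-missing 1≤n (in-ℓ₀∖S ℓ₀∖S≡ (here refl)) (in-ℓ₀∖S ℓ₀∖S≡ (there (here refl)))
                                    (distinct (subst Unique ℓ₀∖S≡ (filter⁺ _ normalised-unique)))
                                    (in-S∖ℓ₀ S∖ℓ₀≡ (here refl)) (in-S∖ℓ₀ S∖ℓ₀≡ (there (here refl)))
                                    (distinct (subst Unique S∖ℓ₀≡ (filter⁺ _ S-unique))))))
      by-shape Rs@(_ ∷ _ ∷ _ ∷ _) _ ℓ₀∖S≡ _ _ =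
        inj₂ (many-missing-arith q (length Rs) n _ (missing-count ℓ₀∖S≡) (s≤s (s≤s (s≤s z≤n))) 4≤n
                (subst (λ Rs → length Rs * n ≤ ∑ Rs external-through + length Rs) ℓ₀∖S≡ ∣ℓ₀∖S∣*∣ℓ₀∩S∣≤))
      by-shape (_ ∷ [])     []                _ _ ()
      by-shape (_ ∷ [])     (_ ∷ _ ∷ _)       _ _ ()
      by-shape (_ ∷ _ ∷ []) []                _ _ ()
      by-shape (_ ∷ _ ∷ []) (_ ∷ [])          _ _ ()
      by-shape (_ ∷ _ ∷ []) (_ ∷ _ ∷ _ ∷ _)   _ _ ()

  u₀-trichotomy : length S ≡ suc q →
                  let u = u₀ F S in q * q ≤ 3 * u + 2 * q ⊎ (u + 3 ≤ 2 * q ⊎ 3 * q ≤ u + 9)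
  u₀-trichotomy ∣S∣≡q+1 = subst (λ u → q * q ≤ 3 * u + 2 * q ⊎ (u + 3 ≤ 2 * q ⊎ 3 * q ≤ u + 9)) (sym u₀≡∑external)
                                (by-cases (all? (λ ℓ → ∣ ℓ ∩S∣ ≤? 3) (lines F)))
    where
    u : ℕ
    u = ∑[ ℓ ∈ lines F ] 𝟙 (external? ℓ)
    few-points-bound : All (λ ℓ → ∣ ℓ ∩S∣ ≤ 3) (lines F) → q * q ≤ 3 * u + 2 * q
    few-points-bound ≤3 = few-points-arith q u (begin
      3 * (q * q + q + 1) + suc q * (suc q + q)
        ≡⟨ cong₂ (λ a b → 3 * a + b) ∑-points-1 (trans ∑-∣∩S∣² (cong (λ s → s * (s + q)) ∣S∣≡q+1)) ⟨
      3 * ∑[ _ ∈ lines F ] 1 + ∑[ ℓ ∈ lines F ] (∣ ℓ ∩S∣ * ∣ ℓ ∩S∣)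
        ≤⟨ all-∣∩S∣≤3⇒ ≤3 ⟩
      4 * ∑[ ℓ ∈ lines F ] ∣ ℓ ∩S∣ + 3 * u
        ≡⟨ cong (λ a → 4 * a + 3 * u) (trans ∑-∣∩S∣ (cong (_* suc q) ∣S∣≡q+1)) ⟩
      4 * (suc q * suc q) + 3 * u ∎)
      where open ≤-Reasoning
    by-cases : Dec (All (λ ℓ → ∣ ℓ ∩S∣ ≤ 3) (lines F)) → q * q ≤ 3 * u + 2 * q ⊎ (u + 3 ≤ 2 * q ⊎ 3 * q ≤ u + 9)
    by-cases (yes ≤3) = inj₁ (few-points-bound ≤3)
    by-cases (no ¬≤3) with find (¬All⇒Any¬ (λ ℓ → ∣ ℓ ∩S∣ ≤? 3) (lines F) ¬≤3)
    ... | ℓ₀ , ℓ₀∈ , ∣ℓ₀∩S∣≰3 = inj₂ (LongSecant.dichotomy ∣S∣≡q+1 ℓ₀∈ (≰⇒> ∣ℓ₀∩S∣≰3))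

lemma4p17 : (q : ℕ) (F : FiniteField q) → 7 < q →
    (S : List (Triple F)) → All (_∈ points F) S → Unique S → length S ≡ suc q →
    ¬ ((2 * q ∸ 2 ≤ u₀ F S) × (u₀ F S ≤ 3 * q ∸ 10))
lemma4p17 q F 8≤q S S⊆points S-unique ∣S∣≡q+1 (lo , hi) =
  [ (λ q²≤3u+2q → few-points-excluded q u 8≤q q²≤3u+2q u+10≤3q)
  , dichotomy-excluded q u (2q∸2≤u⇒2q≤u+2 q u lo) u+10≤3q
  ]′ (PointSet.u₀-trichotomy F S S⊆points S-unique ∣S∣≡q+1)
  where
  u : ℕ
  u = u₀ F S
  u+10≤3q : u + 10 ≤ 3 * q
  u+10≤3q = u≤3q∸10⇒u+10≤3q q u 8≤q hi
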